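{- Let $\mathbb{F}$ be a field of characteristic different from $2$ in which $-1$ is not a square. Let $m\in\mathbb{F}[X]$ be a non-unit dividing $z^2+1$ for some $z\in\mathbb{F}[X]$ with $\deg(z)<\deg(m)$. Then the Euclidean algorithm (polynomial division) applied to $(m,z)$ yields a last nonzero remainder $u$ which is a unit (nonzero constant) and a quotient sequence of the form \[ (u q_s,\,u^{ -1}q_{s-1},\,\ldots,\,u^{(-1)^{s-1}}q_1,\,u^{(-1)^{s}}q_1,\,\ldots,\,u^{ -1}q_s) \] for some polynomials $q_1,\ldots,q_s$, and setting $x=[q_1,\ldots,q_s]$, $y=[q_2,\ldots,q_s]$ one has $m/u=x^2+y^2$.
   Context: Continuants: $[\,]=1$, $[q_1]=q_1$, $[q_1,q_2]=q_1q_2+1$, $[q_1,\ldots,q_n]=[q_1,\ldots,q_{n-1}]q_n+[q_1,\ldots,q_{n-2}]$ for $n\ge3$. The Euclidean algorithm on $(\tau_1,\tau_2)$: while $\tau_2\neq0$, divide $\tau_1=q\tau_2+t$ with $\deg t<\deg\tau_2$ (or $t=0$), record the quotient $q$, and replace $(\tau_1,\tau_2)$ by $(\tau_2,t)$; the final $\tau_1$ is the last nonzero remainder. -}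

module Defs where

open import Level using (Level; _⊔_)
open import Algebra.Bundles using (CommutativeRing)
import Data.Nat as ℕ
open import Data.Nat using (ℕ; zero; suc; _<_)
open import Data.List using (List; []; _∷_; map; zipWith; reverse; upTo; drop; _++_)
open import Data.List.Relation.Binary.Pointwise using (Pointwise)
open import Data.Product using (Σ; ∃; ∃₂; _×_; _,_)
open import Data.Sum using (_⊎_)
open import Relation.Nullary using (¬_)

record IsField {c ℓ : Level} (R : CommutativeRing c ℓ) : Set (c ⊔ ℓ) where
  open CommutativeRing R
  field
    0≉1     : ¬ (0# ≈ 1#)
    inverse : ∀ x → ¬ (x ≈ 0#) → ∃ λ y → x * y ≈ 1#

-- Polynomials over R, as coefficient lists (lowest degree first),
-- with equality "same coefficient in every degree" (trailing zeros ignored).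
module Poly {c ℓ : Level} (R : CommutativeRing c ℓ) where
  open CommutativeRing R renaming (Carrier to F)

  Pol : Set c
  Pol = List F

  coeff : Pol → ℕ → F
  coeff []      _       = 0#
  coeff (a ∷ p) zero    = a
  coeff (a ∷ p) (suc i) = coeff p i

  infix 4 _≈ₚ_
  _≈ₚ_ : Pol → Pol → Set ℓ
  p ≈ₚ q = ∀ i → coeff p i ≈ coeff q i

  C : F → Pol
  C a = a ∷ []

  0ₚ 1ₚ : Pol
  0ₚ = []
  1ₚ = C 1#

  infixl 6 _+ₚ_
  _+ₚ_ : Pol → Pol → Pol
  []      +ₚ q       = q
  (a ∷ p) +ₚ []      = a ∷ p
  (a ∷ p) +ₚ (b ∷ q) = (a + b) ∷ (p +ₚ q)

  _·ₚ_ : F → Pol → Pol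
  a ·ₚ p = map (a *_) p

  infixl 7 _*ₚ_
  _*ₚ_ : Pol → Pol → Pol
  []      *ₚ q = []
  (a ∷ p) *ₚ q = (a ·ₚ q) +ₚ (0# ∷ (p *ₚ q))

  HasDeg : Pol → ℕ → Set ℓ
  HasDeg p d = ¬ (coeff p d ≈ 0#) × (∀ i → d < i → coeff p i ≈ 0#)

  DegLt : Pol → Pol → Set ℓ
  DegLt p q = ∃₂ λ d e → HasDeg p d × HasDeg q e × d < e

  IsUnitₚ : Pol → Set (c ⊔ ℓ)
  IsUnitₚ p = ∃ λ v → p *ₚ v ≈ₚ 1ₚ

  _∣ₚ_ : Pol → Pol → Set (c ⊔ ℓ)
  m ∣ₚ p = ∃ λ k → p ≈ₚ m *ₚ k

  data Euclid : Pol → Pol → List Pol → Pol → Set (c ⊔ ℓ) where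
    done : ∀ {τ₁ τ₂} → τ₂ ≈ₚ 0ₚ → Euclid τ₁ τ₂ [] τ₁
    step : ∀ {τ₁ τ₂ q t qs u} →
           ¬ (τ₂ ≈ₚ 0ₚ) →
           τ₁ ≈ₚ q *ₚ τ₂ +ₚ t →
           (t ≈ₚ 0ₚ ⊎ DegLt t τ₂) →
           Euclid τ₂ t qs u →
           Euclid τ₁ τ₂ (q ∷ qs) u

  -- Continuants: [ ] = 1, [q₁] = q₁, [q₁,…,qₙ] = [q₁,…,qₙ₋₁] qₙ + [q₁,…,qₙ₋₂].
  -- contGo prev cur qs continues the recurrence with K_{n-2} = prev, K_{n-1} = cur
  -- (starting from K_{-1} = 0, K_0 = 1).
  contGo : Pol → Pol → List Pol → Pol
  contGo prev cur []       = cur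
  contGo prev cur (q ∷ qs) = contGo cur (cur *ₚ q +ₚ prev) qs

  cont : List Pol → Pol
  cont qs = contGo 0ₚ 1ₚ qs

  -- altW a b k = a if k even, b if k odd   (i.e. u^{(-1)^k} with a = u, b = u⁻¹)
  altW : F → F → ℕ → F
  altW a b zero    = a
  altW a b (suc k) = altW b a k

  -- given constants a = u, b = u⁻¹ and (q₁,…,q_s), the sequence
  -- (u q_s, u⁻¹ q_{s-1}, …, u^{(-1)^{s-1}} q₁, u^{(-1)^s} q₁, …, u⁻¹ q_s)
  palSeq : F → F → ℕ → List Pol → List Pol
  palSeq a b s qs =
    zipWith (λ k p → altW a b k ·ₚ p) (upTo s) (reverse qs)
    ++
    zipWith (λ k p → altW a b k ·ₚ p) (map (s ℕ.+_) (upTo s)) qs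

  SeqEq : List Pol → List Pol → Set (c ⊔ ℓ)
  SeqEq = Pointwise _≈ₚ_

-- The Euclidean algorithm writes m = u·K(q₁…qₙ) and z = u·K(q₂…qₙ), where K is the continuant,
-- and the matrix ∏ᵢ [[qᵢ,1],[1,0]] of continuants has determinant (−1)ⁿ.  From m ∣ z² + 1 we get
-- u ∣ 1, so u is a nonzero constant a; multiplying the determinant identity by z then shows
-- K(q₁…qₙ₋₁) ≡ (−1)ⁿ a z (mod m/a), and as both sides have degree below deg m they are equal.
-- Since m/a and K(q₁…qₙ₋₁) are the last two continuants of the reversed sequence, the algorithm
-- run on (m/a, (−1)ⁿ a z), whose quotients are those of (m, z) rescaled alternately, must return
-- the reversed quotients.  For odd n its last remainder forces a² = −1; for even n the quotients
-- form a rescaled palindrome reverse ps ++ ps, and K(reverse ps ++ ps) = K(ps)² + K(tail ps)².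

{-# OPTIONS --safe #-}
module Submission where

open import Defs
open import Level using (Level)
open import Algebra.Bundles using (CommutativeRing; CommutativeSemiring)
open import Algebra.Structures.Biased using (IsCommutativeSemiringˡ)
import Algebra.Solver.Ring.NaturalCoefficients.Default as NaturalCoefficients
open import Relation.Binary.Structures using (IsEquivalence)
open import Relation.Binary.Bundles using (Setoid)
import Relation.Binary.Reasoning.Setoid as SetoidReasoning
open import Data.Nat as ℕ using (ℕ; zero; suc; _≤_; _<_; z≤n; s≤s; _≤?_)
import Data.Nat.Properties as ℕₚ
open import Data.Nat.Properties using (m≤n⇒∃[o]m+o≡n; suc-injective; m≤n⇒m⊓n≡m; m+n∸m≡n; ≤-trans; ≤-refl; n≤1+n; m≤m+n; m≤n+m; ≰⇒>; <-cmp; m≤n⇒m<n∨m≡n)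
open import Data.List using (List; []; _∷_; [_]; take; drop; foldr; length; _++_; reverse; zipWith; applyUpTo)
open import Data.List.Properties using (unfold-reverse; reverse-++; length-reverse; length-++; length-take; length-drop; take++drop≡id; map-upTo)
open import Data.List.Relation.Binary.Pointwise as Pointwise using (Pointwise; []; _∷_)
open import Data.List.Relation.Unary.All using (All; []; _∷_)
open import Data.List.Relation.Unary.All.Properties using (∷ʳ⁺)
open import Data.Product using (_×_; _,_; proj₁; proj₂; ∃; ∃₂; swap)
open import Data.Sum using (_⊎_; inj₁; inj₂; [_,_]′; map₂)
open import Data.Empty using (⊥-elim)
open import Function using (id; _∘_)
open import Relation.Nullary using (¬_; yes; no)
open import Relation.Binary.Definitions using (tri<; tri≈; tri>)
import Relation.Binary.PropositionalEquality as ≡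
open ≡ using (_≡_)

even⊎odd : ∀ n → (∃ λ s → n ≡ s ℕ.+ s) ⊎ (∃ λ s → n ≡ suc (s ℕ.+ s))
even⊎odd zero    = inj₁ (0 , ≡.refl)
even⊎odd (suc n) with even⊎odd n
... | inj₁ (s , n≡s+s)   = inj₂ (s , ≡.cong suc n≡s+s)
... | inj₂ (s , n≡1+s+s) = inj₁ (suc s , ≡.trans (≡.cong suc n≡1+s+s) (≡.cong suc (≡.sym (ℕₚ.+-suc s s))))

0<n+n⇒0<n : ∀ n → 0 < n ℕ.+ n → 0 < n
0<n+n⇒0<n (suc n) _ = s≤s z≤n

All-reverse : ∀ {a p} {A : Set a} {P : A → Set p} {xs} → All P xs → All P (reverse xs)
All-reverse []                         = []
All-reverse {P = P} {x ∷ xs} (px ∷ pxs) = ≡.subst (All P) (≡.sym (unfold-reverse x xs)) (∷ʳ⁺ (All-reverse pxs) px)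

module _ {a r} (S : Setoid a r) where
  open Setoid S renaming (Carrier to A)

  Pointwise-++⁻ˡ : ∀ ws xs {ys zs} → length ws ≡ length xs →
                   Pointwise _≈_ (ws ++ ys) (xs ++ zs) → Pointwise _≈_ ws xs
  Pointwise-++⁻ˡ []       []       _         _              = []
  Pointwise-++⁻ˡ (w ∷ ws) (x ∷ xs) |ws|≡|xs| (w≈x ∷ ws≈xs) = w≈x ∷ Pointwise-++⁻ˡ ws xs (suc-injective |ws|≡|xs|) ws≈xs
  Pointwise-++⁻ˡ []       (x ∷ xs) ()        _
  Pointwise-++⁻ˡ (w ∷ ws) []       ()        _

  even-palindrome : ∀ s w → length w ≡ s ℕ.+ s → Pointwise _≈_ (reverse w) w →
                    ∃ λ ps → length ps ≡ s × Pointwise _≈_ w (reverse ps ++ ps)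
  even-palindrome s w |w|≡s+s rev-w≈w =
    ys , |ys|≡s , ≡.subst (λ v → Pointwise _≈_ v (reverse ys ++ ys)) (≡.sym w≡xs++ys)
                    (Pointwise.++⁺ (Pointwise.symmetric sym rev-ys≈xs) (Pointwise.refl refl))
    where
    xs ys : List A
    xs = take s w
    ys = drop s w
    w≡xs++ys : w ≡ xs ++ ys
    w≡xs++ys = ≡.sym (take++drop≡id s w)
    |xs|≡s : length xs ≡ s
    |xs|≡s = ≡.trans (length-take s w) (≡.trans (≡.cong (s ℕ.⊓_) |w|≡s+s) (m≤n⇒m⊓n≡m (m≤m+n s s)))
    |ys|≡s : length ys ≡ s
    |ys|≡s = ≡.trans (length-drop s w) (≡.trans (≡.cong (ℕ._∸ s) |w|≡s+s) (m+n∸m≡n s s))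
    rev-ys≈xs : Pointwise _≈_ (reverse ys) xs
    rev-ys≈xs = Pointwise-++⁻ˡ (reverse ys) xs (≡.trans (length-reverse ys) (≡.trans |ys|≡s (≡.sym |xs|≡s)))
      (≡.subst₂ (Pointwise _≈_) (≡.trans (≡.cong reverse w≡xs++ys) (reverse-++ xs ys)) w≡xs++ys rev-w≈w)

module PolynomialArithmetic {c ℓ : Level} (R : CommutativeRing c ℓ) where
  open CommutativeRing R renaming (Carrier to F)
  open Poly R
  open SetoidReasoning setoid
  module Scalar = NaturalCoefficients commutativeSemiring

  coeff-+ₚ : ∀ p q i → coeff (p +ₚ q) i ≈ coeff p i + coeff q i
  coeff-+ₚ []      q       i       = sym (+-identityˡ _)
  coeff-+ₚ (a ∷ p) []      i       = sym (+-identityʳ _)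
  coeff-+ₚ (a ∷ p) (b ∷ q) zero    = refl
  coeff-+ₚ (a ∷ p) (b ∷ q) (suc i) = coeff-+ₚ p q i

  coeff-·ₚ : ∀ a p i → coeff (a ·ₚ p) i ≈ a * coeff p i
  coeff-·ₚ a []      i       = sym (zeroʳ a)
  coeff-·ₚ a (b ∷ p) zero    = refl
  coeff-·ₚ a (b ∷ p) (suc i) = coeff-·ₚ a p i

  coeff-drop1 : ∀ p i → coeff (drop 1 p) i ≈ coeff p (suc i)
  coeff-drop1 []      i = refl
  coeff-drop1 (a ∷ p) i = refl

  coeff-*ₚ-zero : ∀ p q → coeff (p *ₚ q) 0 ≈ coeff p 0 * coeff q 0
  coeff-*ₚ-zero []      q = sym (zeroˡ _)
  coeff-*ₚ-zero (a ∷ p) q = begin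
    coeff (a ·ₚ q +ₚ (0# ∷ p *ₚ q)) 0 ≈⟨ coeff-+ₚ (a ·ₚ q) _ 0 ⟩
    coeff (a ·ₚ q) 0 + 0#             ≈⟨ +-identityʳ _ ⟩
    coeff (a ·ₚ q) 0                  ≈⟨ coeff-·ₚ a q 0 ⟩
    a * coeff q 0                     ∎

  coeff-*ₚ-suc : ∀ p q i →
    coeff (p *ₚ q) (suc i) ≈ coeff p 0 * coeff q (suc i) + coeff (drop 1 p *ₚ q) i
  coeff-*ₚ-suc []      q i = sym (trans (+-congʳ (zeroˡ _)) (+-identityˡ _))
  coeff-*ₚ-suc (a ∷ p) q i = begin
    coeff (a ·ₚ q +ₚ (0# ∷ p *ₚ q)) (suc i) ≈⟨ coeff-+ₚ (a ·ₚ q) (0# ∷ p *ₚ q) (suc i) ⟩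
    coeff (a ·ₚ q) (suc i) + coeff (p *ₚ q) i ≈⟨ +-congʳ (coeff-·ₚ a q (suc i)) ⟩
    a * coeff q (suc i) + coeff (p *ₚ q) i    ∎

  -- p ≈ₚ q unfolds to a Π-type, from which p and q cannot be inferred; the record restores inference.
  infix 4 _≋_
  record _≋_ (p q : Pol) : Set ℓ where
    constructor coeffwise
    field ≋⇒≈ₚ : p ≈ₚ q
  open _≋_ public

  ≋-refl : ∀ {p} → p ≋ p
  ≋-refl = coeffwise λ _ → refl

  ≋-sym : ∀ {p q} → p ≋ q → q ≋ p
  ≋-sym (coeffwise e) = coeffwise λ i → sym (e i)

  ≋-trans : ∀ {p q r} → p ≋ q → q ≋ r → p ≋ r
  ≋-trans (coeffwise e) (coeffwise f) = coeffwise λ i → trans (e i) (f i)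

  ≋-isEquivalence : IsEquivalence _≋_
  ≋-isEquivalence = record { refl = ≋-refl ; sym = ≋-sym ; trans = ≋-trans }

  ≈ₚ-setoid : Setoid c ℓ
  ≈ₚ-setoid = record
    { Carrier       = Pol
    ; _≈_           = _≈ₚ_
    ; isEquivalence = record { refl = λ _ → refl ; sym = λ e i → sym (e i) ; trans = λ e f i → trans (e i) (f i) }
    }

  ∷-cong : ∀ {a b p q} → a ≈ b → p ≋ q → (a ∷ p) ≋ (b ∷ q)
  ∷-cong a≈b (coeffwise e) = coeffwise λ { zero → a≈b ; (suc i) → e i }

  drop1-cong : ∀ {p q} → p ≋ q → drop 1 p ≋ drop 1 q
  drop1-cong {p} {q} (coeffwise e) =
    coeffwise λ i → trans (coeff-drop1 p i) (trans (e (suc i)) (sym (coeff-drop1 q i)))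

  +ₚ-cong : ∀ {p p′ q q′} → p ≋ p′ → q ≋ q′ → p +ₚ q ≋ p′ +ₚ q′
  +ₚ-cong {p} {p′} {q} {q′} (coeffwise e) (coeffwise f) = coeffwise λ i →
    trans (coeff-+ₚ p q i) (trans (+-cong (e i) (f i)) (sym (coeff-+ₚ p′ q′ i)))

  ·ₚ-cong : ∀ {a b p q} → a ≈ b → p ≋ q → a ·ₚ p ≋ b ·ₚ q
  ·ₚ-cong {a} {b} {p} {q} a≈b (coeffwise e) = coeffwise λ i →
    trans (coeff-·ₚ a p i) (trans (*-cong a≈b (e i)) (sym (coeff-·ₚ b q i)))

  *ₚ-cong : ∀ {p p′ q q′} → p ≋ p′ → q ≋ q′ → p *ₚ q ≋ p′ *ₚ q′
  *ₚ-cong p≋p′ q≋q′ = coeffwise λ i → go i p≋p′ q≋q′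
    where
    go : ∀ i {p p′ q q′} → p ≋ p′ → q ≋ q′ → coeff (p *ₚ q) i ≈ coeff (p′ *ₚ q′) i
    go zero {p} {p′} {q} {q′} e f = begin
      coeff (p *ₚ q) 0          ≈⟨ coeff-*ₚ-zero p q ⟩
      coeff p 0 * coeff q 0     ≈⟨ *-cong (≋⇒≈ₚ e 0) (≋⇒≈ₚ f 0) ⟩
      coeff p′ 0 * coeff q′ 0   ≈⟨ coeff-*ₚ-zero p′ q′ ⟨
      coeff (p′ *ₚ q′) 0        ∎
    go (suc i) {p} {p′} {q} {q′} e f = begin
      coeff (p *ₚ q) (suc i)                                    ≈⟨ coeff-*ₚ-suc p q i ⟩
      coeff p 0 * coeff q (suc i) + coeff (drop 1 p *ₚ q) i     ≈⟨ +-cong (*-cong (≋⇒≈ₚ e 0) (≋⇒≈ₚ f (suc i))) (go i (drop1-cong e) f) ⟩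
      coeff p′ 0 * coeff q′ (suc i) + coeff (drop 1 p′ *ₚ q′) i ≈⟨ coeff-*ₚ-suc p′ q′ i ⟨
      coeff (p′ *ₚ q′) (suc i)                                  ∎

  +ₚ-assoc : ∀ p q r → (p +ₚ q) +ₚ r ≋ p +ₚ (q +ₚ r)
  +ₚ-assoc p q r = coeffwise λ i → begin
    coeff ((p +ₚ q) +ₚ r) i             ≈⟨ trans (coeff-+ₚ (p +ₚ q) r i) (+-congʳ (coeff-+ₚ p q i)) ⟩
    (coeff p i + coeff q i) + coeff r i ≈⟨ +-assoc _ _ _ ⟩
    coeff p i + (coeff q i + coeff r i) ≈⟨ trans (coeff-+ₚ p (q +ₚ r) i) (+-congˡ (coeff-+ₚ q r i)) ⟨
    coeff (p +ₚ (q +ₚ r)) i             ∎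

  +ₚ-comm : ∀ p q → p +ₚ q ≋ q +ₚ p
  +ₚ-comm p q = coeffwise λ i → trans (coeff-+ₚ p q i) (trans (+-comm _ _) (sym (coeff-+ₚ q p i)))

  +ₚ-identityʳ : ∀ p → p +ₚ 0ₚ ≋ p
  +ₚ-identityʳ []      = ≋-refl
  +ₚ-identityʳ (a ∷ p) = ≋-refl

  coeff-·ₚ-*ₚ : ∀ i a p q → coeff ((a ·ₚ p) *ₚ q) i ≈ a * coeff (p *ₚ q) i
  coeff-·ₚ-*ₚ zero a p q = begin
    coeff ((a ·ₚ p) *ₚ q) 0        ≈⟨ coeff-*ₚ-zero (a ·ₚ p) q ⟩
    coeff (a ·ₚ p) 0 * coeff q 0   ≈⟨ *-congʳ (coeff-·ₚ a p 0) ⟩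
    (a * coeff p 0) * coeff q 0    ≈⟨ *-assoc _ _ _ ⟩
    a * (coeff p 0 * coeff q 0)    ≈⟨ *-congˡ (coeff-*ₚ-zero p q) ⟨
    a * coeff (p *ₚ q) 0           ∎
  coeff-·ₚ-*ₚ (suc i) a p q = begin
    coeff ((a ·ₚ p) *ₚ q) (suc i)                                      ≈⟨ coeff-*ₚ-suc (a ·ₚ p) q i ⟩
    coeff (a ·ₚ p) 0 * coeff q (suc i) + coeff (drop 1 (a ·ₚ p) *ₚ q) i ≈⟨ +-cong (*-congʳ (coeff-·ₚ a p 0)) (≋⇒≈ₚ (*ₚ-cong (drop1-· p) ≋-refl) i) ⟩
    (a * coeff p 0) * coeff q (suc i) + coeff ((a ·ₚ drop 1 p) *ₚ q) i ≈⟨ +-cong (*-assoc _ _ _) (coeff-·ₚ-*ₚ i a (drop 1 p) q) ⟩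
    a * (coeff p 0 * coeff q (suc i)) + a * coeff (drop 1 p *ₚ q) i    ≈⟨ distribˡ _ _ _ ⟨
    a * (coeff p 0 * coeff q (suc i) + coeff (drop 1 p *ₚ q) i)        ≈⟨ *-congˡ (coeff-*ₚ-suc p q i) ⟨
    a * coeff (p *ₚ q) (suc i)                                         ∎
    where
    drop1-· : ∀ p → drop 1 (a ·ₚ p) ≋ a ·ₚ drop 1 p
    drop1-· []      = ≋-refl
    drop1-· (b ∷ p) = ≋-refl

  coeff-*ₚ-distribʳ : ∀ i p p′ q → coeff ((p +ₚ p′) *ₚ q) i ≈ coeff (p *ₚ q) i + coeff (p′ *ₚ q) i
  coeff-*ₚ-distribʳ zero p p′ q = begin
    coeff ((p +ₚ p′) *ₚ q) 0                        ≈⟨ coeff-*ₚ-zero (p +ₚ p′) q ⟩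
    coeff (p +ₚ p′) 0 * coeff q 0                   ≈⟨ *-congʳ (coeff-+ₚ p p′ 0) ⟩
    (coeff p 0 + coeff p′ 0) * coeff q 0            ≈⟨ distribʳ _ _ _ ⟩
    coeff p 0 * coeff q 0 + coeff p′ 0 * coeff q 0  ≈⟨ +-cong (coeff-*ₚ-zero p q) (coeff-*ₚ-zero p′ q) ⟨
    coeff (p *ₚ q) 0 + coeff (p′ *ₚ q) 0            ∎
  coeff-*ₚ-distribʳ (suc i) p p′ q = begin
    coeff ((p +ₚ p′) *ₚ q) (suc i)
      ≈⟨ coeff-*ₚ-suc (p +ₚ p′) q i ⟩
    coeff (p +ₚ p′) 0 * coeff q (suc i) + coeff (drop 1 (p +ₚ p′) *ₚ q) i
      ≈⟨ +-cong (*-congʳ (coeff-+ₚ p p′ 0)) (≋⇒≈ₚ (*ₚ-cong (drop1-+ p p′) ≋-refl) i) ⟩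
    (coeff p 0 + coeff p′ 0) * coeff q (suc i) + coeff ((drop 1 p +ₚ drop 1 p′) *ₚ q) i
      ≈⟨ +-cong (distribʳ _ _ _) (coeff-*ₚ-distribʳ i (drop 1 p) (drop 1 p′) q) ⟩
    (x + x′) + (y + y′)
      ≈⟨ Scalar.solve 4 (λ x x′ y y′ → (x :+ x′) :+ (y :+ y′) := (x :+ y) :+ (x′ :+ y′)) refl x x′ y y′ ⟩
    (x + y) + (x′ + y′)
      ≈⟨ +-cong (coeff-*ₚ-suc p q i) (coeff-*ₚ-suc p′ q i) ⟨
    coeff (p *ₚ q) (suc i) + coeff (p′ *ₚ q) (suc i)
      ∎
    where
    open Scalar using (_:+_; _:=_)
    x x′ y y′ : F
    x = coeff p 0 * coeff q (suc i)
    x′ = coeff p′ 0 * coeff q (suc i)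
    y = coeff (drop 1 p *ₚ q) i
    y′ = coeff (drop 1 p′ *ₚ q) i
    drop1-+ : ∀ p p′ → drop 1 (p +ₚ p′) ≋ drop 1 p +ₚ drop 1 p′
    drop1-+ []      p′       = ≋-refl
    drop1-+ (a ∷ p) []       = ≋-sym (+ₚ-identityʳ p)
    drop1-+ (a ∷ p) (b ∷ p′) = ≋-refl

  *ₚ-distribʳ : ∀ q p p′ → (p +ₚ p′) *ₚ q ≋ p *ₚ q +ₚ p′ *ₚ q
  *ₚ-distribʳ q p p′ = coeffwise λ i →
    trans (coeff-*ₚ-distribʳ i p p′ q) (sym (coeff-+ₚ (p *ₚ q) (p′ *ₚ q) i))

  *ₚ-assoc : ∀ p q r → (p *ₚ q) *ₚ r ≋ p *ₚ (q *ₚ r)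
  *ₚ-assoc p q r = coeffwise λ i → go i p q r
    where
    drop1-*ₚ : ∀ p q → drop 1 (p *ₚ q) ≋ coeff p 0 ·ₚ drop 1 q +ₚ drop 1 p *ₚ q
    drop1-*ₚ p q = coeffwise λ i → begin
      coeff (drop 1 (p *ₚ q)) i                                 ≈⟨ coeff-drop1 (p *ₚ q) i ⟩
      coeff (p *ₚ q) (suc i)                                    ≈⟨ coeff-*ₚ-suc p q i ⟩
      coeff p 0 * coeff q (suc i) + coeff (drop 1 p *ₚ q) i     ≈⟨ +-congʳ (trans (*-congˡ (sym (coeff-drop1 q i))) (sym (coeff-·ₚ _ (drop 1 q) i))) ⟩
      coeff (coeff p 0 ·ₚ drop 1 q) i + coeff (drop 1 p *ₚ q) i ≈⟨ coeff-+ₚ (coeff p 0 ·ₚ drop 1 q) (drop 1 p *ₚ q) i ⟨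
      coeff (coeff p 0 ·ₚ drop 1 q +ₚ drop 1 p *ₚ q) i          ∎
    go : ∀ i p q r → coeff ((p *ₚ q) *ₚ r) i ≈ coeff (p *ₚ (q *ₚ r)) i
    go zero p q r = begin
      coeff ((p *ₚ q) *ₚ r) 0               ≈⟨ trans (coeff-*ₚ-zero (p *ₚ q) r) (*-congʳ (coeff-*ₚ-zero p q)) ⟩
      (coeff p 0 * coeff q 0) * coeff r 0   ≈⟨ *-assoc _ _ _ ⟩
      coeff p 0 * (coeff q 0 * coeff r 0)   ≈⟨ trans (coeff-*ₚ-zero p (q *ₚ r)) (*-congˡ (coeff-*ₚ-zero q r)) ⟨
      coeff (p *ₚ (q *ₚ r)) 0               ∎
    go (suc i) p q r = begin
      coeff ((p *ₚ q) *ₚ r) (suc i)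
        ≈⟨ coeff-*ₚ-suc (p *ₚ q) r i ⟩
      coeff (p *ₚ q) 0 * coeff r (suc i) + coeff (drop 1 (p *ₚ q) *ₚ r) i
        ≈⟨ +-cong (*-congʳ (coeff-*ₚ-zero p q)) (≋⇒≈ₚ (*ₚ-cong (drop1-*ₚ p q) ≋-refl) i) ⟩
      (a * b) * x + coeff ((a ·ₚ drop 1 q +ₚ drop 1 p *ₚ q) *ₚ r) i
        ≈⟨ +-congˡ (coeff-*ₚ-distribʳ i (a ·ₚ drop 1 q) (drop 1 p *ₚ q) r) ⟩
      (a * b) * x + (coeff ((a ·ₚ drop 1 q) *ₚ r) i + coeff ((drop 1 p *ₚ q) *ₚ r) i)
        ≈⟨ +-congˡ (+-cong (coeff-·ₚ-*ₚ i a (drop 1 q) r) (go i (drop 1 p) q r)) ⟩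
      (a * b) * x + (a * y + z)
        ≈⟨ Scalar.solve 5 (λ a b x y z → (a :* b) :* x :+ (a :* y :+ z) := a :* (b :* x :+ y) :+ z) refl a b x y z ⟩
      a * (b * x + y) + z
        ≈⟨ trans (coeff-*ₚ-suc p (q *ₚ r) i) (+-congʳ (*-congˡ (coeff-*ₚ-suc q r i))) ⟨
      coeff (p *ₚ (q *ₚ r)) (suc i)
        ∎
      where
      open Scalar using (_:+_; _:*_; _:=_)
      a b x y z : F
      a = coeff p 0
      b = coeff q 0
      x = coeff r (suc i)
      y = coeff (drop 1 q *ₚ r) i
      z = coeff (drop 1 p *ₚ (q *ₚ r)) i

  *ₚ-identityˡ : ∀ p → 1ₚ *ₚ p ≋ p
  *ₚ-identityˡ p = coeffwise λ
    { zero    → trans (coeff-*ₚ-zero 1ₚ p) (*-identityˡ _)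
    ; (suc i) → trans (coeff-*ₚ-suc 1ₚ p i) (trans (+-identityʳ _) (*-identityˡ _))
    }

  *ₚ-zeroʳ : ∀ p → p *ₚ 0ₚ ≋ 0ₚ
  *ₚ-zeroʳ []      = ≋-refl
  *ₚ-zeroʳ (a ∷ p) = coeffwise λ { zero → refl ; (suc i) → ≋⇒≈ₚ (*ₚ-zeroʳ p) i }

  *ₚ-∷ʳ : ∀ q a p → q *ₚ (a ∷ p) ≋ a ·ₚ q +ₚ (0# ∷ q *ₚ p)
  *ₚ-∷ʳ []      a p = coeffwise λ { zero → refl ; (suc i) → refl }
  *ₚ-∷ʳ (b ∷ q) a p = coeffwise λ { zero → +-congʳ (*-comm b a) ; (suc i) → higher i }
    where
    open Scalar using (_:+_; _:=_)
    higher : ∀ i → coeff (b ·ₚ p +ₚ q *ₚ (a ∷ p)) i ≈ coeff (a ·ₚ q +ₚ (b ·ₚ p +ₚ (0# ∷ q *ₚ p))) i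
    higher i = begin
      coeff (b ·ₚ p +ₚ q *ₚ (a ∷ p)) i                      ≈⟨ trans (coeff-+ₚ (b ·ₚ p) _ i) (+-congˡ (≋⇒≈ₚ (*ₚ-∷ʳ q a p) i)) ⟩
      coeff (b ·ₚ p) i + coeff (a ·ₚ q +ₚ (0# ∷ q *ₚ p)) i  ≈⟨ +-congˡ (coeff-+ₚ (a ·ₚ q) _ i) ⟩
      x + (y + z)                                           ≈⟨ Scalar.solve 3 (λ x y z → x :+ (y :+ z) := y :+ (x :+ z)) refl x y z ⟩
      y + (x + z)                                           ≈⟨ trans (coeff-+ₚ (a ·ₚ q) _ i) (+-congˡ (coeff-+ₚ (b ·ₚ p) _ i)) ⟨
      coeff (a ·ₚ q +ₚ (b ·ₚ p +ₚ (0# ∷ q *ₚ p))) i         ∎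
      where
      x y z : F
      x = coeff (b ·ₚ p) i
      y = coeff (a ·ₚ q) i
      z = coeff (0# ∷ q *ₚ p) i

  *ₚ-comm : ∀ p q → p *ₚ q ≋ q *ₚ p
  *ₚ-comm []      q = ≋-sym (*ₚ-zeroʳ q)
  *ₚ-comm (a ∷ p) q = ≋-sym (≋-trans (*ₚ-∷ʳ q a p) (+ₚ-cong ≋-refl (∷-cong refl (*ₚ-comm q p))))

  Pol-commutativeSemiring : CommutativeSemiring c ℓ
  Pol-commutativeSemiring = record
    { Carrier = Pol ; _≈_ = _≋_ ; _+_ = _+ₚ_ ; _*_ = _*ₚ_ ; 0# = 0ₚ ; 1# = 1ₚ
    ; isCommutativeSemiring = IsCommutativeSemiringˡ.isCommutativeSemiring record
      { +-isCommutativeMonoid = record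
        { isMonoid = record
          { isSemigroup = record
            { isMagma = record { isEquivalence = ≋-isEquivalence ; ∙-cong = +ₚ-cong }
            ; assoc = +ₚ-assoc }
          ; identity = (λ _ → ≋-refl) , +ₚ-identityʳ }
        ; comm = +ₚ-comm }
      ; *-isCommutativeMonoid = record
        { isMonoid = record
          { isSemigroup = record
            { isMagma = record { isEquivalence = ≋-isEquivalence ; ∙-cong = *ₚ-cong }
            ; assoc = *ₚ-assoc }
          ; identity = *ₚ-identityˡ , λ p → ≋-trans (*ₚ-comm p 1ₚ) (*ₚ-identityˡ p) }
        ; comm = *ₚ-comm }
      ; distribʳ = *ₚ-distribʳ
      ; zeroˡ = λ _ → ≋-refl }
    }

module PolynomialRing {c ℓ : Level} (R : CommutativeRing c ℓ) where
  open CommutativeRing R renaming (Carrier to F)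
  open import Algebra.Properties.Ring ring using (-1*x≈-x; x∙y⁻¹≈ε⇒x≈y; +-inverseˡ-unique; +-cancelˡ)
  open Poly R
  open PolynomialArithmetic R public
  module ≋-Reasoning = SetoidReasoning (CommutativeSemiring.setoid Pol-commutativeSemiring)
  open ≋-Reasoning
  module PolySolver = NaturalCoefficients Pol-commutativeSemiring
  open PolySolver using (solve; _:+_; _:*_; _:=_; con)

  ·ₚ≋C*ₚ : ∀ a p → a ·ₚ p ≋ C a *ₚ p
  ·ₚ≋C*ₚ a p = coeffwise λ i →
    sym (trans (coeff-+ₚ (a ·ₚ p) (0# ∷ []) i) (trans (+-congˡ (zero-poly i)) (+-identityʳ _)))
    where
    zero-poly : ∀ i → coeff (0# ∷ []) i ≈ 0#
    zero-poly zero    = refl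
    zero-poly (suc i) = refl

  C-cong : ∀ {a b} → a ≈ b → C a ≋ C b
  C-cong a≈b = ∷-cong a≈b ≋-refl

  C-*ₚ-C : ∀ a b → C a *ₚ C b ≋ C (a * b)
  C-*ₚ-C a b = coeffwise λ { zero → +-identityʳ _ ; (suc i) → refl }

  C-0 : C 0# ≋ 0ₚ
  C-0 = coeffwise λ { zero → refl ; (suc i) → refl }

  ·ₚ-·ₚ : ∀ a b p → a ·ₚ (b ·ₚ p) ≋ (a * b) ·ₚ p
  ·ₚ-·ₚ a b p = begin
    a ·ₚ (b ·ₚ p)       ≈⟨ ≋-trans (·ₚ≋C*ₚ a _) (*ₚ-cong (≋-refl {C a}) (·ₚ≋C*ₚ b p)) ⟩
    C a *ₚ (C b *ₚ p)   ≈⟨ solve 3 (λ a b p → a :* (b :* p) := (a :* b) :* p) ≋-refl (C a) (C b) p ⟩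
    (C a *ₚ C b) *ₚ p   ≈⟨ *ₚ-cong (C-*ₚ-C a b) (≋-refl {p}) ⟩
    C (a * b) *ₚ p      ≈⟨ ·ₚ≋C*ₚ (a * b) p ⟨
    (a * b) ·ₚ p        ∎

  ·ₚ-identityˡ : ∀ p → 1# ·ₚ p ≋ p
  ·ₚ-identityˡ p = ≋-trans (·ₚ≋C*ₚ 1# p) (*ₚ-identityˡ p)

  infix 8 -ₚ_
  -ₚ_ : Pol → Pol
  -ₚ p = C (- 1#) *ₚ p

  coeff--ₚ : ∀ p i → coeff (-ₚ p) i ≈ - coeff p i
  coeff--ₚ p i = trans (sym (≋⇒≈ₚ (·ₚ≋C*ₚ (- 1#) p) i)) (trans (coeff-·ₚ (- 1#) p i) (-1*x≈-x _))

  +ₚ-inverseʳ : ∀ p → p +ₚ -ₚ p ≋ 0ₚ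
  +ₚ-inverseʳ p = coeffwise λ i →
    trans (coeff-+ₚ p (-ₚ p) i) (trans (+-congˡ (coeff--ₚ p i)) (-‿inverseʳ _))

  p-q≋0⇒p≋q : ∀ {p q} → p +ₚ -ₚ q ≋ 0ₚ → p ≋ q
  p-q≋0⇒p≋q {p} {q} (coeffwise e) = coeffwise λ i → x∙y⁻¹≈ε⇒x≈y _ _
    (trans (+-congˡ (sym (coeff--ₚ q i))) (trans (sym (coeff-+ₚ p (-ₚ q) i)) (e i)))

  +ₚ-moveʳ : ∀ {p q r} → p +ₚ q ≋ r → p ≋ r +ₚ -ₚ q
  +ₚ-moveʳ {p} {q} {r} p+q≋r = begin
    p                        ≈⟨ solve 1 (λ p → p := p :+ con 0) ≋-refl p ⟩
    p +ₚ 0ₚ                  ≈⟨ +ₚ-cong (≋-refl {p}) (+ₚ-inverseʳ q) ⟨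
    p +ₚ (q +ₚ -ₚ q)         ≈⟨ solve 3 (λ p q n → p :+ (q :+ n) := (p :+ q) :+ n) ≋-refl p q (-ₚ q) ⟩
    (p +ₚ q) +ₚ -ₚ q         ≈⟨ +ₚ-cong p+q≋r (≋-refl { -ₚ q}) ⟩
    r +ₚ -ₚ q                ∎

  u*x+1≋u*y⇒u*[y-x]≋1 : ∀ u x y → u *ₚ x +ₚ 1ₚ ≋ u *ₚ y → u *ₚ (y +ₚ -ₚ x) ≋ 1ₚ
  u*x+1≋u*y⇒u*[y-x]≋1 u x y ux+1≋uy = begin
    u *ₚ (y +ₚ -ₚ x)                  ≈⟨ solve 4 (λ u x y n → u :* (y :+ n :* x) := u :* y :+ n :* (u :* x)) ≋-refl u x y (C (- 1#)) ⟩
    u *ₚ y +ₚ -ₚ (u *ₚ x)             ≈⟨ +ₚ-cong ux+1≋uy (≋-refl { -ₚ (u *ₚ x)}) ⟨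
    u *ₚ x +ₚ 1ₚ +ₚ -ₚ (u *ₚ x)       ≈⟨ solve 2 (λ v n → v :+ con 1 :+ n := con 1 :+ (v :+ n)) ≋-refl (u *ₚ x) (-ₚ (u *ₚ x)) ⟩
    1ₚ +ₚ (u *ₚ x +ₚ -ₚ (u *ₚ x))     ≈⟨ +ₚ-cong (≋-refl {1ₚ}) (+ₚ-inverseʳ (u *ₚ x)) ⟩
    1ₚ +ₚ 0ₚ                          ≈⟨ +ₚ-identityʳ 1ₚ ⟩
    1ₚ                                ∎

  +ₚ-cancelˡ : ∀ {p q r} → p +ₚ q ≋ p +ₚ r → q ≋ r
  +ₚ-cancelˡ {p} {q} {r} (coeffwise e) = coeffwise λ i →
    +-cancelˡ (coeff p i) _ _ (trans (sym (coeff-+ₚ p q i)) (trans (e i) (coeff-+ₚ p r i)))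

module Degrees {c ℓ : Level} (R : CommutativeRing c ℓ) where
  open CommutativeRing R renaming (Carrier to F)
  open Poly R
  open PolynomialRing R
  open SetoidReasoning setoid

  DegBelow : Pol → ℕ → Set ℓ
  DegBelow p e = ∀ i → e ≤ i → coeff p i ≈ 0#

  DegBelow-resp-≋ : ∀ {p q e} → p ≋ q → DegBelow p e → DegBelow q e
  DegBelow-resp-≋ (coeffwise p≈q) p<e i e≤i = trans (sym (p≈q i)) (p<e i e≤i)

  DegBelow-mono : ∀ p {e e′} → e ≤ e′ → DegBelow p e → DegBelow p e′
  DegBelow-mono p e≤e′ p<e i e′≤i = p<e i (≤-trans e≤e′ e′≤i)

  DegBelow-0⇒≋0ₚ : ∀ p → DegBelow p 0 → p ≋ 0ₚ
  DegBelow-0⇒≋0ₚ p p<0 = coeffwise λ i → p<0 i z≤n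

  ≋0ₚ⇒DegBelow : ∀ {p} e → p ≋ 0ₚ → DegBelow p e
  ≋0ₚ⇒DegBelow e (coeffwise p≈0) i _ = p≈0 i

  DegBelow-+ₚ : ∀ p q {e} → DegBelow p e → DegBelow q e → DegBelow (p +ₚ q) e
  DegBelow-+ₚ p q p<e q<e i e≤i =
    trans (coeff-+ₚ p q i) (trans (+-cong (p<e i e≤i) (q<e i e≤i)) (+-identityˡ 0#))

  DegBelow-·ₚ : ∀ a p {e} → DegBelow p e → DegBelow (a ·ₚ p) e
  DegBelow-·ₚ a p p<e i e≤i = trans (coeff-·ₚ a p i) (trans (*-congˡ (p<e i e≤i)) (zeroʳ a))

  DegBelow--ₚ : ∀ p {e} → DegBelow p e → DegBelow (-ₚ p) e
  DegBelow--ₚ p p<e = DegBelow-resp-≋ (·ₚ≋C*ₚ (- 1#) p) (DegBelow-·ₚ (- 1#) p p<e)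

  DegBelow-drop1 : ∀ p {e} → DegBelow p (suc e) → DegBelow (drop 1 p) e
  DegBelow-drop1 p p<1+e i e≤i = trans (coeff-drop1 p i) (p<1+e (suc i) (s≤s e≤i))

  DegBelow-*ₚ : ∀ q p j e → DegBelow q j → DegBelow p (suc e) → DegBelow (q *ₚ p) (j ℕ.+ e)
  DegBelow-*ₚ q p zero e q<0 p≤e = ≋0ₚ⇒DegBelow e (*ₚ-cong (DegBelow-0⇒≋0ₚ q q<0) (≋-refl {p}))
  DegBelow-*ₚ q p (suc j) e q<1+j p≤e zero ()
  DegBelow-*ₚ q p (suc j) e q<1+j p≤e (suc i) (s≤s j+e≤i) = begin
    coeff (q *ₚ p) (suc i)                                 ≈⟨ coeff-*ₚ-suc q p i ⟩
    coeff q 0 * coeff p (suc i) + coeff (drop 1 q *ₚ p) i  ≈⟨ +-cong (*-congˡ (p≤e (suc i) (s≤s (≤-trans (m≤n+m e j) j+e≤i))))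
                                                                     (DegBelow-*ₚ (drop 1 q) p j e (DegBelow-drop1 q q<1+j) p≤e i j+e≤i) ⟩
    coeff q 0 * 0# + 0#                                    ≈⟨ trans (+-identityʳ _) (zeroʳ _) ⟩
    0#                                                     ∎

  coeff-*ₚ-top : ∀ q p j e → DegBelow q (suc j) → DegBelow p (suc e) →
                 coeff (q *ₚ p) (j ℕ.+ e) ≈ coeff q j * coeff p e
  coeff-*ₚ-top q p zero zero q≤0 p≤0 = coeff-*ₚ-zero q p
  coeff-*ₚ-top q p zero (suc e) q≤0 p≤e = begin
    coeff (q *ₚ p) (suc e)                                 ≈⟨ coeff-*ₚ-suc q p e ⟩
    coeff q 0 * coeff p (suc e) + coeff (drop 1 q *ₚ p) e  ≈⟨ +-congˡ (≋⇒≈ₚ (*ₚ-cong (DegBelow-0⇒≋0ₚ (drop 1 q) (DegBelow-drop1 q q≤0)) (≋-refl {p})) e) ⟩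
    coeff q 0 * coeff p (suc e) + 0#                       ≈⟨ +-identityʳ _ ⟩
    coeff q 0 * coeff p (suc e)                            ∎
  coeff-*ₚ-top q p (suc j) e q≤1+j p≤e = begin
    coeff (q *ₚ p) (suc (j ℕ.+ e))                                        ≈⟨ coeff-*ₚ-suc q p (j ℕ.+ e) ⟩
    coeff q 0 * coeff p (suc (j ℕ.+ e)) + coeff (drop 1 q *ₚ p) (j ℕ.+ e) ≈⟨ +-congʳ (trans (*-congˡ (p≤e _ (s≤s (m≤n+m e j)))) (zeroʳ _)) ⟩
    0# + coeff (drop 1 q *ₚ p) (j ℕ.+ e)                                  ≈⟨ +-identityˡ _ ⟩
    coeff (drop 1 q *ₚ p) (j ℕ.+ e)                                       ≈⟨ coeff-*ₚ-top (drop 1 q) p j e (DegBelow-drop1 q q≤1+j) p≤e ⟩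
    coeff (drop 1 q) j * coeff p e                                        ≈⟨ *-congʳ (coeff-drop1 q j) ⟩
    coeff q (suc j) * coeff p e                                           ∎

  DegBelow-∷-*ₚ⁻ : ∀ x r p {e k} → DegBelow p (suc e) → e ≤ k →
                   DegBelow ((x ∷ r) *ₚ p) (suc k) → DegBelow (r *ₚ p) k
  DegBelow-∷-*ₚ⁻ x r p p≤e e≤k xrp≤k i k≤i = begin
    coeff (r *ₚ p) i                              ≈⟨ +-identityˡ _ ⟨
    0# + coeff (r *ₚ p) i                         ≈⟨ +-congʳ (trans (*-congˡ (p≤e (suc i) (s≤s (≤-trans e≤k k≤i)))) (zeroʳ x)) ⟨
    x * coeff p (suc i) + coeff (r *ₚ p) i        ≈⟨ coeff-*ₚ-suc (x ∷ r) p i ⟨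
    coeff ((x ∷ r) *ₚ p) (suc i)                  ≈⟨ xrp≤k (suc i) (s≤s k≤i) ⟩
    0#                                            ∎

  HasDeg-resp-≋ : ∀ {p q d} → p ≋ q → HasDeg p d → HasDeg q d
  HasDeg-resp-≋ {d = d} p≋q (lead≉0 , p≤d) =
    (λ lead≈0 → lead≉0 (trans (≋⇒≈ₚ p≋q d) lead≈0)) , DegBelow-resp-≋ p≋q p≤d

  HasDeg-unique : ∀ p {d d′} → HasDeg p d → HasDeg p d′ → d ≡ d′
  HasDeg-unique p {d} {d′} (lead≉0 , p≤d) (lead′≉0 , p≤d′) with <-cmp d d′
  ... | tri< d<d′ _ _ = ⊥-elim (lead′≉0 (p≤d d′ d<d′))
  ... | tri≈ _ d≡d′ _ = d≡d′
  ... | tri> _ _ d′<d = ⊥-elim (lead≉0 (p≤d′ d d′<d))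

  HasDeg-DegBelow-< : ∀ p {d e} → HasDeg p d → DegBelow p e → d < e
  HasDeg-DegBelow-< p {d} {e} (lead≉0 , _) p<e with e ≤? d
  ... | yes e≤d = ⊥-elim (lead≉0 (p<e d e≤d))
  ... | no  e≰d = ≰⇒> e≰d

  HasDeg-≉0ₚ : ∀ p {d} → HasDeg p d → ¬ (p ≈ₚ 0ₚ)
  HasDeg-≉0ₚ p {d} (lead≉0 , _) p≈0 = lead≉0 (p≈0 d)

  HasDeg-+ₚ : ∀ p t {d} → HasDeg p d → DegBelow t d → HasDeg (p +ₚ t) d
  HasDeg-+ₚ p t {d} (lead≉0 , p≤d) t<d = lead+t≉0 , DegBelow-+ₚ p t p≤d (DegBelow-mono t (n≤1+n d) t<d)
    where
    lead+t≉0 : ¬ (coeff (p +ₚ t) d ≈ 0#)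
    lead+t≉0 lead+t≈0 = lead≉0 (begin
      coeff p d                  ≈⟨ +-identityʳ _ ⟨
      coeff p d + 0#             ≈⟨ +-congˡ (t<d d ≤-refl) ⟨
      coeff p d + coeff t d      ≈⟨ coeff-+ₚ p t d ⟨
      coeff (p +ₚ t) d           ≈⟨ lead+t≈0 ⟩
      0#                         ∎)

  HasDeg-0⇒≋C : ∀ p → HasDeg p 0 → p ≋ C (coeff p 0)
  HasDeg-0⇒≋C p (_ , p≤0) = coeffwise λ { zero → refl ; (suc i) → p≤0 (suc i) (s≤s z≤n) }

  DegBelow-lower : ∀ p {d} → DegBelow p (suc d) → coeff p d ≈ 0# → DegBelow p d
  DegBelow-lower p p≤d lead≈0 i d≤i with m≤n⇒m<n∨m≡n d≤i
  ... | inj₁ d<i   = p≤d i d<i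
  ... | inj₂ ≡.refl = lead≈0

module FieldDegrees {c ℓ : Level} (R : CommutativeRing c ℓ) (isField : IsField R) where
  open CommutativeRing R renaming (Carrier to F)
  open IsField isField
  open Poly R
  open PolynomialRing R
  open Degrees R
  open SetoidReasoning setoid

  x*y≈0⇒x≈0 : ∀ {x y} → ¬ (y ≈ 0#) → x * y ≈ 0# → x ≈ 0#
  x*y≈0⇒x≈0 {x} {y} y≉0 xy≈0 = begin
    x              ≈⟨ *-identityʳ x ⟨
    x * 1#         ≈⟨ *-congˡ (proj₂ (inverse y y≉0)) ⟨
    x * (y * y⁻¹)  ≈⟨ *-assoc x y y⁻¹ ⟨
    (x * y) * y⁻¹  ≈⟨ *-congʳ xy≈0 ⟩
    0# * y⁻¹       ≈⟨ zeroˡ y⁻¹ ⟩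
    0#             ∎
    where
    y⁻¹ : F
    y⁻¹ = proj₁ (inverse y y≉0)

  x≉0∧y≉0⇒x*y≉0 : ∀ {x y} → ¬ (x ≈ 0#) → ¬ (y ≈ 0#) → ¬ (x * y ≈ 0#)
  x≉0∧y≉0⇒x*y≉0 x≉0 y≉0 xy≈0 = x≉0 (x*y≈0⇒x≈0 y≉0 xy≈0)

  invertible⇒≉0 : ∀ {x y} → x * y ≈ 1# → ¬ (x ≈ 0#)
  invertible⇒≉0 {x} {y} xy≈1 x≈0 = 0≉1 (trans (sym (zeroˡ y)) (trans (*-congʳ (sym x≈0)) xy≈1))

  HasDeg-·ₚ : ∀ {a} p {d} → ¬ (a ≈ 0#) → HasDeg p d → HasDeg (a ·ₚ p) d
  HasDeg-·ₚ {a} p {d} a≉0 (lead≉0 , p≤d) =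
    (λ lead≈0 → x≉0∧y≉0⇒x*y≉0 a≉0 lead≉0 (trans (sym (coeff-·ₚ a p d)) lead≈0)) , DegBelow-·ₚ a p p≤d

  HasDeg-*ₚ : ∀ q p {a b} → HasDeg q a → HasDeg p b → HasDeg (q *ₚ p) (a ℕ.+ b)
  HasDeg-*ₚ q p {a} {b} (q-lead≉0 , q≤a) (p-lead≉0 , p≤b) =
    (λ lead≈0 → x≉0∧y≉0⇒x*y≉0 q-lead≉0 p-lead≉0 (trans (sym (coeff-*ₚ-top q p a b q≤a p≤b)) lead≈0)) ,
    DegBelow-*ₚ q p (suc a) b q≤a p≤b

  DegBelow-*ₚ-cancelʳ : ∀ r p j {e} → HasDeg p e → DegBelow (r *ₚ p) (j ℕ.+ e) → DegBelow r j
  DegBelow-*ₚ-cancelʳ []      p j       p-deg _ i _ = refl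
  DegBelow-*ₚ-cancelʳ (x ∷ r) p (suc j) p-deg xrp<1+j+e zero ()
  DegBelow-*ₚ-cancelʳ (x ∷ r) p (suc j) {e} p-deg xrp<1+j+e (suc i) (s≤s j≤i) =
    DegBelow-*ₚ-cancelʳ r p j p-deg (DegBelow-∷-*ₚ⁻ x r p (proj₂ p-deg) (m≤n+m e j) xrp<1+j+e) i j≤i
  DegBelow-*ₚ-cancelʳ (x ∷ r) p zero {e} p-deg xrp<e = λ { zero _ → x≈0 ; (suc i) _ → ≋⇒≈ₚ r≋0 i }
    where
    r≋0 : r ≋ 0ₚ
    r≋0 = DegBelow-0⇒≋0ₚ r (DegBelow-*ₚ-cancelʳ r p 0 p-deg
            (DegBelow-∷-*ₚ⁻ x r p (proj₂ p-deg) ≤-refl (DegBelow-mono ((x ∷ r) *ₚ p) (n≤1+n e) xrp<e)))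
    x≈0 : x ≈ 0#
    x≈0 = x*y≈0⇒x≈0 (proj₁ p-deg) (begin
      x * coeff p e                 ≈⟨ coeff-*ₚ-top (x ∷ r) p 0 e (λ { (suc i) _ → ≋⇒≈ₚ r≋0 i }) (proj₂ p-deg) ⟨
      coeff ((x ∷ r) *ₚ p) e        ≈⟨ xrp<e e ≤-refl ⟩
      0#                            ∎)

  HasDeg-*ₚ-cancelʳ : ∀ q p d {e} → HasDeg p e → HasDeg (q *ₚ p) (d ℕ.+ e) → HasDeg q d
  HasDeg-*ₚ-cancelʳ q p d {e} p-deg (qp-lead≉0 , qp≤d+e) = q-lead≉0 , q≤d
    where
    q≤d : DegBelow q (suc d)
    q≤d = DegBelow-*ₚ-cancelʳ q p (suc d) p-deg qp≤d+e
    q-lead≉0 : ¬ (coeff q d ≈ 0#)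
    q-lead≉0 lead≈0 = qp-lead≉0 (DegBelow-*ₚ q p d e (DegBelow-lower q q≤d lead≈0) (proj₂ p-deg) (d ℕ.+ e) ≤-refl)

  division-unique : ∀ q q′ t t′ τ {e} → HasDeg τ e → DegBelow t e → DegBelow t′ e →
                    q *ₚ τ +ₚ t ≋ q′ *ₚ τ +ₚ t′ → q ≋ q′ × t ≋ t′
  division-unique q q′ t t′ τ {e} τ-deg t<e t′<e eq = q≋q′ , +ₚ-cancelˡ (≋-trans eq (+ₚ-cong (*ₚ-cong (≋-sym q≋q′) (≋-refl {τ})) (≋-refl {t′})))
    where
    high-agree : ∀ i → e ≤ i → coeff (q *ₚ τ) i ≈ coeff (q′ *ₚ τ) i
    high-agree i e≤i = begin
      coeff (q *ₚ τ) i                      ≈⟨ +-identityʳ _ ⟨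
      coeff (q *ₚ τ) i + 0#                 ≈⟨ trans (+-congˡ (sym (t<e i e≤i))) (sym (coeff-+ₚ (q *ₚ τ) t i)) ⟩
      coeff (q *ₚ τ +ₚ t) i                 ≈⟨ ≋⇒≈ₚ eq i ⟩
      coeff (q′ *ₚ τ +ₚ t′) i               ≈⟨ trans (coeff-+ₚ (q′ *ₚ τ) t′ i) (+-congˡ (t′<e i e≤i)) ⟩
      coeff (q′ *ₚ τ) i + 0#                ≈⟨ +-identityʳ _ ⟩
      coeff (q′ *ₚ τ) i                     ∎
    difference : (q +ₚ -ₚ q′) *ₚ τ ≋ q *ₚ τ +ₚ -ₚ (q′ *ₚ τ)
    difference = PolySolver.solve 4 (λ q q′ n τ → (q :+ n :* q′) :* τ := q :* τ :+ n :* (q′ :* τ)) ≋-refl q q′ (C (- 1#)) τ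
      where open PolySolver using (_:+_; _:*_; _:=_)
    q≋q′ : q ≋ q′
    q≋q′ = p-q≋0⇒p≋q (DegBelow-0⇒≋0ₚ (q +ₚ -ₚ q′) (DegBelow-*ₚ-cancelʳ (q +ₚ -ₚ q′) τ 0 τ-deg λ i e≤i → begin
      coeff ((q +ₚ -ₚ q′) *ₚ τ) i                   ≈⟨ ≋⇒≈ₚ difference i ⟩
      coeff (q *ₚ τ +ₚ -ₚ (q′ *ₚ τ)) i              ≈⟨ coeff-+ₚ (q *ₚ τ) (-ₚ (q′ *ₚ τ)) i ⟩
      coeff (q *ₚ τ) i + coeff (-ₚ (q′ *ₚ τ)) i     ≈⟨ +-cong (high-agree i e≤i) (coeff--ₚ (q′ *ₚ τ) i) ⟩
      coeff (q′ *ₚ τ) i + - coeff (q′ *ₚ τ) i       ≈⟨ -‿inverseʳ _ ⟩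
      0#                                            ∎))

  HasDeg-1ₚ : HasDeg 1ₚ 0
  HasDeg-1ₚ = (λ 1≈0 → 0≉1 (sym 1≈0)) , λ { zero () ; (suc i) _ → refl }

  unit⇒HasDeg-0 : ∀ u v {d} → u *ₚ v ≋ 1ₚ → HasDeg u d → d ≡ 0
  unit⇒HasDeg-0 u v {zero}  _    _     = ≡.refl
  unit⇒HasDeg-0 u v {suc d} uv≋1 u-deg = ⊥-elim (0≉1 (begin
    0#                  ≈⟨ ≋⇒≈ₚ (*ₚ-zeroʳ u) 0 ⟨
    coeff (u *ₚ 0ₚ) 0   ≈⟨ ≋⇒≈ₚ (*ₚ-cong (≋-refl {u}) v≋0) 0 ⟨
    coeff (u *ₚ v) 0    ≈⟨ ≋⇒≈ₚ uv≋1 0 ⟩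
    1#                  ∎))
    where
    vu<1+d : DegBelow (v *ₚ u) (suc d)
    vu<1+d = DegBelow-resp-≋ (≋-sym (≋-trans (*ₚ-comm v u) uv≋1)) (λ { zero () ; (suc i) _ → refl })
    v≋0 : v ≋ 0ₚ
    v≋0 = DegBelow-0⇒≋0ₚ v (DegBelow-*ₚ-cancelʳ v u 0 u-deg vu<1+d)

module Convergents {c ℓ : Level} (R : CommutativeRing c ℓ) where
  open CommutativeRing R renaming (Carrier to F)
  open Poly R
  open PolynomialRing R
  open ≋-Reasoning
  open PolySolver using (solve; _:+_; _:*_; _:=_; con)

  record Mat : Set c where
    constructor mat
    field e₁₁ e₁₂ e₂₁ e₂₂ : Pol
  open Mat

  infix 4 _≋ₘ_
  record _≋ₘ_ (M N : Mat) : Set ℓ where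
    constructor entrywise
    field
      ≋₁₁ : e₁₁ M ≋ e₁₁ N
      ≋₁₂ : e₁₂ M ≋ e₁₂ N
      ≋₂₁ : e₂₁ M ≋ e₂₁ N
      ≋₂₂ : e₂₂ M ≋ e₂₂ N
  open _≋ₘ_ public

  ≋ₘ-trans : ∀ {M N P} → M ≋ₘ N → N ≋ₘ P → M ≋ₘ P
  ≋ₘ-trans (entrywise a b c d) (entrywise a′ b′ c′ d′) =
    entrywise (≋-trans a a′) (≋-trans b b′) (≋-trans c c′) (≋-trans d d′)

  infixl 7 _⊗_
  _⊗_ : Mat → Mat → Mat
  mat a b c d ⊗ mat a′ b′ c′ d′ =
    mat (a *ₚ a′ +ₚ b *ₚ c′) (a *ₚ b′ +ₚ b *ₚ d′) (c *ₚ a′ +ₚ d *ₚ c′) (c *ₚ b′ +ₚ d *ₚ d′)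

  ⊗-congʳ : ∀ {M N} P → M ≋ₘ N → M ⊗ P ≋ₘ N ⊗ P
  ⊗-congʳ P (entrywise a b c d) = entrywise
    (+ₚ-cong (*ₚ-cong a (≋-refl {e₁₁ P})) (*ₚ-cong b (≋-refl {e₂₁ P})))
    (+ₚ-cong (*ₚ-cong a (≋-refl {e₁₂ P})) (*ₚ-cong b (≋-refl {e₂₂ P})))
    (+ₚ-cong (*ₚ-cong c (≋-refl {e₁₁ P})) (*ₚ-cong d (≋-refl {e₂₁ P})))
    (+ₚ-cong (*ₚ-cong c (≋-refl {e₁₂ P})) (*ₚ-cong d (≋-refl {e₂₂ P})))

  I : Mat
  I = mat 1ₚ 0ₚ 0ₚ 1ₚ

  ⊗-identityˡ : ∀ M → M ≋ₘ I ⊗ M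
  ⊗-identityˡ (mat a b c d) = entrywise (one-zero a c) (one-zero b d) (zero-one a c) (zero-one b d)
    where
    one-zero : ∀ x y → x ≋ 1ₚ *ₚ x +ₚ 0ₚ *ₚ y
    zero-one : ∀ x y → y ≋ 0ₚ *ₚ x +ₚ 1ₚ *ₚ y
    one-zero x y = solve 2 (λ x y → x := con 1 :* x :+ con 0 :* y) ≋-refl x y
    zero-one x y = solve 2 (λ x y → y := con 0 :* x :+ con 1 :* y) ≋-refl x y

  transpose : Mat → Mat
  transpose (mat a b c d) = mat a c b d

  infixr 5 _◃_
  _◃_ : Pol → Mat → Mat
  q ◃ mat a b c d = mat (q *ₚ a +ₚ c) (q *ₚ b +ₚ d) a b

  -- convergents (q₁ ∷ … ∷ qₙ) = ∏ᵢ [[qᵢ, 1], [1, 0]] = [[num, prevNum], [den, prevDen]],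
  -- where num / den is the continued fraction q₁ + 1 / (q₂ + … + 1 / qₙ)
  -- and prevNum / prevDen the one of q₁, …, qₙ₋₁.
  convergents : List Pol → Mat
  convergents = foldr _◃_ I

  num prevNum den prevDen : List Pol → Pol
  num     qs = e₁₁ (convergents qs)
  prevNum qs = e₁₂ (convergents qs)
  den     qs = e₂₁ (convergents qs)
  prevDen qs = e₂₂ (convergents qs)

  ◃-cong : ∀ {q q′ M N} → q ≋ q′ → M ≋ₘ N → q ◃ M ≋ₘ q′ ◃ N
  ◃-cong q≋q′ (entrywise a b c d) = entrywise (+ₚ-cong (*ₚ-cong q≋q′ a) c) (+ₚ-cong (*ₚ-cong q≋q′ b) d) a b

  ◃-⊗ : ∀ q M N → q ◃ (M ⊗ N) ≋ₘ (q ◃ M) ⊗ N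
  ◃-⊗ q (mat a b c d) (mat a′ b′ c′ d′) = entrywise
    (solve 7 (λ q a b c d x z → q :* (a :* x :+ b :* z) :+ (c :* x :+ d :* z) := (q :* a :+ c) :* x :+ (q :* b :+ d) :* z) ≋-refl q a b c d a′ c′)
    (solve 7 (λ q a b c d y w → q :* (a :* y :+ b :* w) :+ (c :* y :+ d :* w) := (q :* a :+ c) :* y :+ (q :* b :+ d) :* w) ≋-refl q a b c d b′ d′)
    ≋-refl ≋-refl

  convergents-++ : ∀ xs ys → convergents (xs ++ ys) ≋ₘ convergents xs ⊗ convergents ys
  convergents-++ [] ys = ⊗-identityˡ (convergents ys)
  convergents-++ (x ∷ xs) ys =
    ≋ₘ-trans (◃-cong {x} (≋-refl {x}) (convergents-++ xs ys)) (◃-⊗ x (convergents xs) (convergents ys))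

  transpose-⊗-◃ : ∀ q M → transpose M ⊗ (q ◃ I) ≋ₘ transpose (q ◃ M)
  transpose-⊗-◃ q (mat a b c d) = entrywise
    (solve 3 (λ q a c → a :* (q :* con 1 :+ con 0) :+ c :* con 1 := q :* a :+ c) ≋-refl q a c)
    (solve 3 (λ q a c → a :* (q :* con 0 :+ con 1) :+ c :* con 0 := a) ≋-refl q a c)
    (solve 3 (λ q b d → b :* (q :* con 1 :+ con 0) :+ d :* con 1 := q :* b :+ d) ≋-refl q b d)
    (solve 3 (λ q b d → b :* (q :* con 0 :+ con 1) :+ d :* con 0 := b) ≋-refl q b d)

  convergents-reverse : ∀ qs → convergents (reverse qs) ≋ₘ transpose (convergents qs)
  convergents-reverse []       = entrywise ≋-refl ≋-refl ≋-refl ≋-refl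
  convergents-reverse (q ∷ qs) rewrite unfold-reverse q qs =
    ≋ₘ-trans (convergents-++ (reverse qs) [ q ])
    (≋ₘ-trans (⊗-congʳ (q ◃ I) (convergents-reverse qs)) (transpose-⊗-◃ q (convergents qs)))

  -- num · prevDen − prevNum · den = (−1)ⁿ, with the terms moved so that no subtraction occurs.
  convergents-det : ∀ qs →
    num qs *ₚ prevDen qs +ₚ C (altW 0# 1# (length qs)) ≋ prevNum qs *ₚ den qs +ₚ C (altW 1# 0# (length qs))
  convergents-det [] = begin
    1ₚ *ₚ 1ₚ +ₚ C 0#   ≈⟨ +ₚ-cong (≋-refl {1ₚ *ₚ 1ₚ}) C-0 ⟩
    1ₚ *ₚ 1ₚ +ₚ 0ₚ     ≈⟨ solve 0 (con 1 :* con 1 :+ con 0 := con 0 :* con 0 :+ con 1) ≋-refl ⟩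
    0ₚ *ₚ 0ₚ +ₚ 1ₚ     ∎
  convergents-det (q ∷ qs) = begin
    (q *ₚ x +ₚ y) *ₚ x′ +ₚ ε₁      ≈⟨ solve 5 (λ q x x′ y e → (q :* x :+ y) :* x′ :+ e := q :* x :* x′ :+ (x′ :* y :+ e)) ≋-refl q x x′ y ε₁ ⟩
    q *ₚ x *ₚ x′ +ₚ (x′ *ₚ y +ₚ ε₁) ≈⟨ +ₚ-cong (≋-refl {q *ₚ x *ₚ x′}) (≋-sym (convergents-det qs)) ⟩
    q *ₚ x *ₚ x′ +ₚ (x *ₚ y′ +ₚ ε₀) ≈⟨ solve 5 (λ q x x′ y′ e → q :* x :* x′ :+ (x :* y′ :+ e) := (q :* x′ :+ y′) :* x :+ e) ≋-refl q x x′ y′ ε₀ ⟩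
    (q *ₚ x′ +ₚ y′) *ₚ x +ₚ ε₀      ∎
    where
    x x′ y y′ ε₀ ε₁ : Pol
    x = num qs
    x′ = prevNum qs
    y = den qs
    y′ = prevDen qs
    ε₀ = C (altW 0# 1# (length qs))
    ε₁ = C (altW 1# 0# (length qs))

  -- Multiplying the determinant identity by c·den turns c·den² ≡ −1 (mod num)
  -- into prevNum ≡ ±c·den (mod num).
  prevNum-congruence : ∀ qs c k → c *ₚ den qs *ₚ den qs +ₚ 1ₚ ≋ num qs *ₚ k →
    (c *ₚ den qs *ₚ prevDen qs) *ₚ num qs +ₚ (prevNum qs +ₚ c *ₚ den qs *ₚ C (altW 0# 1# (length qs)))
      ≋ (k *ₚ prevNum qs) *ₚ num qs +ₚ c *ₚ den qs *ₚ C (altW 1# 0# (length qs))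
  prevNum-congruence qs c k cden²+1≋numk = begin
    (c *ₚ y *ₚ y′) *ₚ x +ₚ (x′ +ₚ c *ₚ y *ₚ ε₀) ≈⟨ solve 6 (λ c x x′ y y′ e → (c :* y :* y′) :* x :+ (x′ :+ c :* y :* e) := c :* y :* (x :* y′ :+ e) :+ x′) ≋-refl c x x′ y y′ ε₀ ⟩
    c *ₚ y *ₚ (x *ₚ y′ +ₚ ε₀) +ₚ x′            ≈⟨ +ₚ-cong (*ₚ-cong (≋-refl {c *ₚ y}) (convergents-det qs)) (≋-refl {x′}) ⟩
    c *ₚ y *ₚ (x′ *ₚ y +ₚ ε₁) +ₚ x′            ≈⟨ solve 4 (λ c x′ y e → c :* y :* (x′ :* y :+ e) :+ x′ := x′ :* (c :* y :* y :+ con 1) :+ c :* y :* e) ≋-refl c x′ y ε₁ ⟩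
    x′ *ₚ (c *ₚ y *ₚ y +ₚ 1ₚ) +ₚ c *ₚ y *ₚ ε₁  ≈⟨ +ₚ-cong (*ₚ-cong (≋-refl {x′}) cden²+1≋numk) (≋-refl {c *ₚ y *ₚ ε₁}) ⟩
    x′ *ₚ (x *ₚ k) +ₚ c *ₚ y *ₚ ε₁             ≈⟨ solve 4 (λ x x′ k e → x′ :* (x :* k) :+ e := (k :* x′) :* x :+ e) ≋-refl x x′ k (c *ₚ y *ₚ ε₁) ⟩
    (k *ₚ x′) *ₚ x +ₚ c *ₚ y *ₚ ε₁             ∎
    where
    x x′ y y′ ε₀ ε₁ : Pol
    x = num qs
    x′ = prevNum qs
    y = den qs
    y′ = prevDen qs
    ε₀ = C (altW 0# 1# (length qs))
    ε₁ = C (altW 1# 0# (length qs))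

  contGo≋ : ∀ prev cur qs → contGo prev cur qs ≋ cur *ₚ num qs +ₚ prev *ₚ den qs
  contGo≋ prev cur []       = solve 2 (λ p c → c := c :* con 1 :+ p :* con 0) ≋-refl prev cur
  contGo≋ prev cur (q ∷ qs) = ≋-trans (contGo≋ cur (cur *ₚ q +ₚ prev) qs)
    (solve 5 (λ p c q a b → (c :* q :+ p) :* a :+ c :* b := c :* (q :* a :+ b) :+ p :* a) ≋-refl prev cur q (num qs) (den qs))

  cont≋num : ∀ qs → cont qs ≋ num qs
  cont≋num qs = ≋-trans (contGo≋ 0ₚ 1ₚ qs) (solve 2 (λ a b → con 1 :* a :+ con 0 :* b := a) ≋-refl (num qs) (den qs))

  convergents-cong : ∀ {xs ys} → SeqEq xs ys → convergents xs ≋ₘ convergents ys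
  convergents-cong []              = entrywise ≋-refl ≋-refl ≋-refl ≋-refl
  convergents-cong {x ∷ xs} {y ∷ ys} (x≈y ∷ xs≈ys) = ◃-cong {x} {y} (coeffwise x≈y) (convergents-cong xs≈ys)

  num-reverse-++ : ∀ ps → num (reverse ps ++ ps) ≋ num ps *ₚ num ps +ₚ den ps *ₚ den ps
  num-reverse-++ ps = ≋-trans (≋₁₁ (convergents-++ (reverse ps) ps))
    (+ₚ-cong (*ₚ-cong (≋₁₁ rev) (≋-refl {num ps})) (*ₚ-cong (≋₁₂ rev) (≋-refl {den ps})))
    where rev = convergents-reverse ps

module AlternatingScaling {c ℓ : Level} (R : CommutativeRing c ℓ) where
  open CommutativeRing R renaming (Carrier to F)
  open Poly R
  open PolynomialRing R
  open Convergents R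

  scaleAlt : F → F → List Pol → List Pol
  scaleAlt a b []       = []
  scaleAlt a b (q ∷ qs) = a ·ₚ q ∷ scaleAlt b a qs

  length-scaleAlt : ∀ a b qs → length (scaleAlt a b qs) ≡ length qs
  length-scaleAlt a b []       = ≡.refl
  length-scaleAlt a b (q ∷ qs) = ≡.cong suc (length-scaleAlt b a qs)

  altW-altW : ∀ n a b → altW (altW a b n) (altW b a n) n ≡ a
  altW-altW zero    a b = ≡.refl
  altW-altW (suc n) a b = altW-altW n a b

  altW-+ : ∀ k i a b → altW a b (k ℕ.+ i) ≡ altW (altW a b k) (altW b a k) i
  altW-+ zero    i a b = ≡.refl
  altW-+ (suc k) i a b = altW-+ k i b a

  altW-double : ∀ s a b → altW a b (s ℕ.+ s) ≡ a
  altW-double s a b = ≡.trans (altW-+ s s a b) (altW-altW s a b)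

  scaleAlt-++ : ∀ a b xs ys →
    scaleAlt a b (xs ++ ys) ≡ scaleAlt a b xs ++ scaleAlt (altW a b (length xs)) (altW b a (length xs)) ys
  scaleAlt-++ a b []       ys = ≡.refl
  scaleAlt-++ a b (x ∷ xs) ys = ≡.cong (a ·ₚ x ∷_) (scaleAlt-++ b a xs ys)

  reverse-scaleAlt : ∀ a b xs →
    reverse (scaleAlt a b xs) ≡ scaleAlt (altW b a (length xs)) (altW a b (length xs)) (reverse xs)
  reverse-scaleAlt a b []       = ≡.refl
  reverse-scaleAlt a b (x ∷ xs) = begin
    reverse (a ·ₚ x ∷ scaleAlt b a xs)            ≡⟨ unfold-reverse (a ·ₚ x) (scaleAlt b a xs) ⟩
    reverse (scaleAlt b a xs) ++ [ a ·ₚ x ]       ≡⟨ ≡.cong₂ (λ zs a′ → zs ++ [ a′ ·ₚ x ]) (reverse-scaleAlt b a xs) (≡.sym (altW-altW n a b)) ⟩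
    scaleAlt α β (reverse xs) ++ [ altW α β n ·ₚ x ]
                                                  ≡⟨ ≡.cong (λ m → scaleAlt α β (reverse xs) ++ scaleAlt (altW α β m) (altW β α m) [ x ]) (≡.sym (length-reverse xs)) ⟩
    scaleAlt α β (reverse xs) ++ scaleAlt (altW α β (length (reverse xs))) (altW β α (length (reverse xs))) [ x ]
                                                  ≡⟨ scaleAlt-++ α β (reverse xs) [ x ] ⟨
    scaleAlt α β (reverse xs ++ [ x ])            ≡⟨ ≡.cong (scaleAlt α β) (unfold-reverse x xs) ⟨
    scaleAlt α β (reverse (x ∷ xs))               ∎
    where
    open ≡.≡-Reasoning
    n : ℕ
    n = length xs
    α β : F
    α = altW a b n
    β = altW b a n

  module SeqEq = Setoid (Pointwise.setoid ≈ₚ-setoid)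
  module SeqEq-Reasoning = SetoidReasoning (Pointwise.setoid ≈ₚ-setoid)

  scaleAlt-cong : ∀ {a a′ b b′ xs ys} → a ≈ a′ → b ≈ b′ → SeqEq xs ys → SeqEq (scaleAlt a b xs) (scaleAlt a′ b′ ys)
  scaleAlt-cong a≈a′ b≈b′ []              = []
  scaleAlt-cong {xs = x ∷ _} {y ∷ _} a≈a′ b≈b′ (x≈y ∷ xs≈ys) =
    ≋⇒≈ₚ (·ₚ-cong {p = x} {y} a≈a′ (coeffwise x≈y)) ∷ scaleAlt-cong b≈b′ a≈a′ xs≈ys

  scaleAlt-scaleAlt : ∀ a b a′ b′ xs → SeqEq (scaleAlt a b (scaleAlt a′ b′ xs)) (scaleAlt (a * a′) (b * b′) xs)
  scaleAlt-scaleAlt a b a′ b′ []       = []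
  scaleAlt-scaleAlt a b a′ b′ (x ∷ xs) = ≋⇒≈ₚ (·ₚ-·ₚ a a′ x) ∷ scaleAlt-scaleAlt b a b′ a′ xs

  scaleAlt-identity : ∀ xs → SeqEq (scaleAlt 1# 1# xs) xs
  scaleAlt-identity []       = []
  scaleAlt-identity (x ∷ xs) = ≋⇒≈ₚ (·ₚ-identityˡ x) ∷ scaleAlt-identity xs

  scaleAlt-inverse : ∀ {a b} → a * b ≈ 1# → ∀ xs → SeqEq (scaleAlt a b (scaleAlt b a xs)) xs
  scaleAlt-inverse {a} {b} ab≈1 xs = begin
    scaleAlt a b (scaleAlt b a xs)  ≈⟨ scaleAlt-scaleAlt a b b a xs ⟩
    scaleAlt (a * b) (b * a) xs     ≈⟨ scaleAlt-cong ab≈1 (trans (*-comm b a) ab≈1) SeqEq.refl ⟩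
    scaleAlt 1# 1# xs               ≈⟨ scaleAlt-identity xs ⟩
    xs                              ∎
    where open SeqEq-Reasoning

  altW-absorb : ∀ {a b} → a * b ≈ 1# → ∀ n → (a * altW 1# b n ≈ altW a 1# n) × (a * altW b 1# n ≈ altW 1# a n)
  altW-absorb {a} ab≈1 zero    = *-identityʳ a , ab≈1
  altW-absorb     ab≈1 (suc n) = swap (altW-absorb ab≈1 n)

  num-scaleAlt : ∀ {a b} → a * b ≈ 1# → ∀ xs →
    num (scaleAlt a b xs) ≋ altW 1# a (length xs) ·ₚ num xs × den (scaleAlt a b xs) ≋ altW b 1# (length xs) ·ₚ den xs
  num-scaleAlt ab≈1 [] = ≋-sym (·ₚ-identityˡ 1ₚ) , ≋-refl
  num-scaleAlt {a} {b} ab≈1 (q ∷ qs) = num-step , proj₁ (num-scaleAlt (trans (*-comm b a) ab≈1) qs)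
    where
    open ≋-Reasoning
    open PolySolver using (solve; _:+_; _:*_; _:=_)
    n : ℕ
    n = length qs
    w w′ : F
    w = altW 1# b n
    w′ = altW a 1# n
    ih : num (scaleAlt b a qs) ≋ w ·ₚ num qs × den (scaleAlt b a qs) ≋ w′ ·ₚ den qs
    ih = num-scaleAlt (trans (*-comm b a) ab≈1) qs
    num-step : num (scaleAlt a b (q ∷ qs)) ≋ w′ ·ₚ num (q ∷ qs)
    num-step = begin
      (a ·ₚ q) *ₚ num (scaleAlt b a qs) +ₚ den (scaleAlt b a qs)
        ≈⟨ +ₚ-cong (*ₚ-cong (·ₚ≋C*ₚ a q) (≋-trans (proj₁ ih) (·ₚ≋C*ₚ w (num qs)))) (≋-trans (proj₂ ih) (·ₚ≋C*ₚ w′ (den qs))) ⟩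
      (C a *ₚ q) *ₚ (C w *ₚ num qs) +ₚ C w′ *ₚ den qs
        ≈⟨ solve 6 (λ A W W′ q N D → (A :* q) :* (W :* N) :+ W′ :* D := (A :* W) :* (q :* N) :+ W′ :* D) ≋-refl (C a) (C w) (C w′) q (num qs) (den qs) ⟩
      (C a *ₚ C w) *ₚ (q *ₚ num qs) +ₚ C w′ *ₚ den qs
        ≈⟨ +ₚ-cong (*ₚ-cong (≋-trans (C-*ₚ-C a w) (C-cong (proj₁ (altW-absorb ab≈1 n)))) (≋-refl {q *ₚ num qs})) (≋-refl {C w′ *ₚ den qs}) ⟩
      C w′ *ₚ (q *ₚ num qs) +ₚ C w′ *ₚ den qs
        ≈⟨ solve 3 (λ W′ x D → W′ :* x :+ W′ :* D := W′ :* (x :+ D)) ≋-refl (C w′) (q *ₚ num qs) (den qs) ⟩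
      C w′ *ₚ (q *ₚ num qs +ₚ den qs)
        ≈⟨ ·ₚ≋C*ₚ w′ (q *ₚ num qs +ₚ den qs) ⟨
      w′ ·ₚ (q *ₚ num qs +ₚ den qs)
        ∎

  palSeq≡scaleAlt : ∀ a b s ps → length ps ≡ s → palSeq a b s ps ≡ scaleAlt a b (reverse ps ++ ps)
  palSeq≡scaleAlt a b s ps |ps|≡s = begin
    palSeq a b s ps
      ≡⟨ ≡.cong₂ _++_ (zipWith-scaleAlt id a b (reverse ps) (≡.trans (length-reverse ps) |ps|≡s) (λ _ → ≡.refl))
                      (≡.trans (≡.cong (λ ks → zipWith scale ks ps) (map-upTo (s ℕ.+_) s))
                               (zipWith-scaleAlt (s ℕ.+_) (altW a b s) (altW b a s) ps |ps|≡s (λ i → altW-+ s i a b))) ⟩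
    scaleAlt a b (reverse ps) ++ scaleAlt (altW a b s) (altW b a s) ps
      ≡⟨ ≡.cong (λ m → scaleAlt a b (reverse ps) ++ scaleAlt (altW a b m) (altW b a m) ps) (≡.trans (length-reverse ps) |ps|≡s) ⟨
    scaleAlt a b (reverse ps) ++ scaleAlt (altW a b (length (reverse ps))) (altW b a (length (reverse ps))) ps
      ≡⟨ scaleAlt-++ a b (reverse ps) ps ⟨
    scaleAlt a b (reverse ps ++ ps)
      ∎
    where
    open ≡.≡-Reasoning
    scale : ℕ → Pol → Pol
    scale k p = altW a b k ·ₚ p
    zipWith-scaleAlt : ∀ f α β xs {n} → length xs ≡ n → (∀ i → altW a b (f i) ≡ altW α β i) →
                       zipWith scale (applyUpTo f n) xs ≡ scaleAlt α β xs
    zipWith-scaleAlt f α β []       {zero}  _  _ = ≡.refl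
    zipWith-scaleAlt f α β []       {suc n} () _
    zipWith-scaleAlt f α β (x ∷ xs) {zero}  () _
    zipWith-scaleAlt f α β (x ∷ xs) {suc n} |xs|≡n f-alt =
      ≡.cong₂ _∷_ (≡.cong (_·ₚ x) (f-alt 0)) (zipWith-scaleAlt (f ∘ suc) β α xs (suc-injective |xs|≡n) (f-alt ∘ suc))

  num-palSeq : ∀ {a b} → a * b ≈ 1# → ∀ s ps → length ps ≡ s →
               num (palSeq a b s ps) ≋ num ps *ₚ num ps +ₚ den ps *ₚ den ps
  num-palSeq {a} {b} ab≈1 s ps |ps|≡s = begin
    num (palSeq a b s ps)                           ≡⟨ ≡.cong num (palSeq≡scaleAlt a b s ps |ps|≡s) ⟩
    num (scaleAlt a b ps′)                          ≈⟨ proj₁ (num-scaleAlt ab≈1 ps′) ⟩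
    altW 1# a (length ps′) ·ₚ num ps′               ≡⟨ ≡.cong (λ w → w ·ₚ num ps′) (≡.trans (≡.cong (altW 1# a) |ps′|≡s+s) (altW-double s 1# a)) ⟩
    1# ·ₚ num ps′                                   ≈⟨ ·ₚ-identityˡ (num ps′) ⟩
    num ps′                                         ≈⟨ num-reverse-++ ps ⟩
    num ps *ₚ num ps +ₚ den ps *ₚ den ps            ∎
    where
    open ≋-Reasoning
    ps′ : List Pol
    ps′ = reverse ps ++ ps
    |ps′|≡s+s : length ps′ ≡ s ℕ.+ s
    |ps′|≡s+s = ≡.trans (length-++ (reverse ps)) (≡.cong₂ ℕ._+_ (≡.trans (length-reverse ps) |ps|≡s) |ps|≡s)

  palSeq-of-scaled-palindrome : ∀ {a b} → a * b ≈ 1# → ∀ s qs → length qs ≡ s ℕ.+ s →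
    SeqEq (scaleAlt (b * b) (a * a) qs) (reverse qs) → ∃ λ ps → length ps ≡ s × SeqEq qs (palSeq a b s ps)
  palSeq-of-scaled-palindrome {a} {b} ab≈1 s qs |qs|≡s+s scaled-palindrome =
    ps , |ps|≡s , qs≈palSeq
    where
    open SeqEq-Reasoning
    w : List Pol
    w = scaleAlt b a qs
    a·bb≈b : a * (b * b) ≈ b
    a·bb≈b = trans (sym (*-assoc a b b)) (trans (*-congʳ ab≈1) (*-identityˡ b))
    b·aa≈a : b * (a * a) ≈ a
    b·aa≈a = trans (sym (*-assoc b a a)) (trans (*-congʳ (trans (*-comm b a) ab≈1)) (*-identityˡ a))
    altW-|qs| : ∀ α β → altW α β (length qs) ≡ α
    altW-|qs| α β = ≡.trans (≡.cong (altW α β) |qs|≡s+s) (altW-double s α β)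
    rev-w≈w : SeqEq (reverse w) w
    rev-w≈w = begin
      reverse (scaleAlt b a qs)                                     ≡⟨ reverse-scaleAlt b a qs ⟩
      scaleAlt (altW a b (length qs)) (altW b a (length qs)) (reverse qs) ≡⟨ ≡.cong₂ (λ α β → scaleAlt α β (reverse qs)) (altW-|qs| a b) (altW-|qs| b a) ⟩
      scaleAlt a b (reverse qs)                                     ≈⟨ scaleAlt-cong refl refl (SeqEq.sym scaled-palindrome) ⟩
      scaleAlt a b (scaleAlt (b * b) (a * a) qs)                    ≈⟨ scaleAlt-scaleAlt a b (b * b) (a * a) qs ⟩
      scaleAlt (a * (b * b)) (b * (a * a)) qs                       ≈⟨ scaleAlt-cong a·bb≈b b·aa≈a SeqEq.refl ⟩
      scaleAlt b a qs                                               ∎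
    palindrome : ∃ λ ps → length ps ≡ s × SeqEq w (reverse ps ++ ps)
    palindrome = even-palindrome ≈ₚ-setoid s w (≡.trans (length-scaleAlt b a qs) |qs|≡s+s) rev-w≈w
    ps : List Pol
    ps = proj₁ palindrome
    |ps|≡s : length ps ≡ s
    |ps|≡s = proj₁ (proj₂ palindrome)
    qs≈palSeq : SeqEq qs (palSeq a b s ps)
    qs≈palSeq = begin
      qs                               ≈⟨ SeqEq.sym (scaleAlt-inverse ab≈1 qs) ⟩
      scaleAlt a b w                   ≈⟨ scaleAlt-cong refl refl (proj₂ (proj₂ palindrome)) ⟩
      scaleAlt a b (reverse ps ++ ps)  ≡⟨ palSeq≡scaleAlt a b s ps |ps|≡s ⟨
      palSeq a b s ps                  ∎

module EuclideanAlgorithm {c ℓ : Level} (R : CommutativeRing c ℓ) (isField : IsField R) where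
  open CommutativeRing R renaming (Carrier to F)
  open IsField isField
  open Poly R
  open PolynomialRing R
  open Degrees R
  open FieldDegrees R isField
  open Convergents R
  open AlternatingScaling R

  NonConstant : Pol → Set ℓ
  NonConstant q = ∃ λ d → HasDeg q (suc d)

  remainder-DegBelow : ∀ t τ {e} → HasDeg τ e → t ≈ₚ 0ₚ ⊎ DegLt t τ → DegBelow t e
  remainder-DegBelow t τ τ-deg (inj₁ t≈0) = ≋0ₚ⇒DegBelow _ (coeffwise {t} t≈0)
  remainder-DegBelow t τ τ-deg (inj₂ (d , e , t-deg , τ-deg′ , d<e)) with HasDeg-unique τ τ-deg′ τ-deg
  ... | ≡.refl = DegBelow-mono t d<e (proj₂ t-deg)

  quotient-HasDeg : ∀ q τ₁ τ₂ t d {e} → τ₁ ≈ₚ q *ₚ τ₂ +ₚ t →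
                    HasDeg τ₁ (d ℕ.+ e) → HasDeg τ₂ e → DegBelow t e → HasDeg q d
  quotient-HasDeg q τ₁ τ₂ t d {e} τ₁≈qτ₂+t τ₁-deg τ₂-deg t<e = HasDeg-*ₚ-cancelʳ q τ₂ d τ₂-deg
    (HasDeg-resp-≋ (≋-sym (+ₚ-moveʳ {q *ₚ τ₂} {t} (≋-sym (coeffwise {τ₁} τ₁≈qτ₂+t))))
      (HasDeg-+ₚ τ₁ (-ₚ t) τ₁-deg (DegBelow--ₚ t (DegBelow-mono t (m≤n+m e d) t<e))))

  euclid-degrees : ∀ {τ₁ τ₂ qs u d} → Euclid τ₁ τ₂ qs u → HasDeg τ₁ d → τ₂ ≈ₚ 0ₚ ⊎ DegLt τ₂ τ₁ →
                   All NonConstant qs × ∃ (HasDeg u)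
  euclid-degrees (done _) τ₁-deg _ = [] , (_ , τ₁-deg)
  euclid-degrees (step τ₂≉0 _ _ _) _ (inj₁ τ₂≈0) = ⊥-elim (τ₂≉0 τ₂≈0)
  euclid-degrees {τ₁} {τ₂} (step {q = q} {t} _ τ₁≈qτ₂+t t-rem rest) τ₁-deg (inj₂ (e , d′ , τ₂-deg , τ₁-deg′ , e<d′))
    with HasDeg-unique τ₁ τ₁-deg′ τ₁-deg | m≤n⇒∃[o]m+o≡n e<d′
  ... | ≡.refl | o , 1+e+o≡d =
    let q-deg = quotient-HasDeg q τ₁ τ₂ t (suc o) τ₁≈qτ₂+t
                  (≡.subst (HasDeg τ₁) (≡.sym (≡.trans (≡.cong suc (ℕₚ.+-comm o e)) 1+e+o≡d)) τ₁-deg)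
                  τ₂-deg (remainder-DegBelow t τ₂ τ₂-deg t-rem)
        rest-degrees = euclid-degrees rest τ₂-deg t-rem
    in ((o , q-deg) ∷ proj₁ rest-degrees) , proj₂ rest-degrees

  euclid-convergents : ∀ {τ₁ τ₂ qs u} → Euclid τ₁ τ₂ qs u → τ₁ ≋ u *ₚ num qs × τ₂ ≋ u *ₚ den qs
  euclid-convergents {τ₁} (done τ₂≈0) = ≋-sym (≋-trans (*ₚ-comm τ₁ 1ₚ) (*ₚ-identityˡ τ₁)) , ≋-trans (coeffwise τ₂≈0) (≋-sym (*ₚ-zeroʳ τ₁))
  euclid-convergents {τ₁} {τ₂} (step {q = q} {t} {qs} {u} _ τ₁≈qτ₂+t _ rest) =
    (begin
      τ₁                                    ≈⟨ coeffwise τ₁≈qτ₂+t ⟩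
      q *ₚ τ₂ +ₚ t                          ≈⟨ +ₚ-cong (*ₚ-cong (≋-refl {q}) τ₂≋) t≋ ⟩
      q *ₚ (u *ₚ num qs) +ₚ u *ₚ den qs     ≈⟨ solve 4 (λ q u a b → q :* (u :* a) :+ u :* b := u :* (q :* a :+ b)) ≋-refl q u (num qs) (den qs) ⟩
      u *ₚ (q *ₚ num qs +ₚ den qs)          ∎) , τ₂≋
    where
    open ≋-Reasoning
    open PolySolver using (solve; _:+_; _:*_; _:=_)
    τ₂≋ : τ₂ ≋ u *ₚ num qs
    τ₂≋ = proj₁ (euclid-convergents rest)
    t≋ : t ≋ u *ₚ den qs
    t≋ = proj₂ (euclid-convergents rest)

  convergents-degree : ∀ {qs} → All NonConstant qs → ∃ λ S → HasDeg (num qs) S × DegBelow (den qs) S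
  convergents-degree [] = 0 , HasDeg-1ₚ , λ _ _ → refl
  convergents-degree {q ∷ qs} ((k , q-deg) ∷ qs-nc) =
    let S , num-deg , den<S = convergents-degree qs-nc
    in suc k ℕ.+ S ,
       HasDeg-+ₚ (q *ₚ num qs) (den qs) (HasDeg-*ₚ q (num qs) q-deg num-deg) (DegBelow-mono (den qs) (m≤n+m S (suc k)) den<S) ,
       DegBelow-mono (num qs) (s≤s (m≤n+m S k)) (proj₂ num-deg)

  den-DegLt-num : ∀ {qs} → All NonConstant qs → den qs ≈ₚ 0ₚ ⊎ DegLt (den qs) (num qs)
  den-DegLt-num []                     = inj₁ λ _ → refl
  den-DegLt-num {q ∷ qs} (q-nc ∷ qs-nc) =
    let S , num-deg , _ = convergents-degree qs-nc
        S′ , num′-deg , den′<S′ = convergents-degree {q ∷ qs} (q-nc ∷ qs-nc)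
    in inj₂ (S , S′ , num-deg , num′-deg , HasDeg-DegBelow-< (num qs) num-deg den′<S′)

  prevNum-DegBelow : ∀ {qs S} → All NonConstant qs → HasDeg (num qs) S → DegBelow (prevNum qs) S
  prevNum-DegBelow {qs} qs-nc num-deg =
    let S′ , num′-deg , den′<S′ = convergents-degree (All-reverse qs-nc)
        reversed = convergents-reverse qs
    in ≡.subst (DegBelow (prevNum qs)) (HasDeg-unique (num qs) (HasDeg-resp-≋ (≋₁₁ reversed) num′-deg) num-deg)
         (DegBelow-resp-≋ (≋₂₁ reversed) den′<S′)

  euclid-of-convergents : ∀ {qs} → All NonConstant qs → Euclid (num qs) (den qs) qs 1ₚ
  euclid-of-convergents []                     = done λ _ → refl
  euclid-of-convergents {q ∷ qs} (q-nc ∷ qs-nc) =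
    step (HasDeg-≉0ₚ (num qs) (proj₁ (proj₂ (convergents-degree qs-nc)))) (λ _ → refl)
         (den-DegLt-num qs-nc) (euclid-of-convergents qs-nc)

  remainder-zero-or-HasDeg : ∀ t τ → t ≈ₚ 0ₚ ⊎ DegLt t τ → t ≈ₚ 0ₚ ⊎ ∃ (HasDeg t)
  remainder-zero-or-HasDeg t τ = map₂ λ (d , _ , t-deg , _) → d , t-deg

  euclid-deterministic : ∀ {τ₁ τ₂ qs u τ₁′ τ₂′ qs′ u′} → Euclid τ₁ τ₂ qs u → Euclid τ₁′ τ₂′ qs′ u′ →
    τ₁ ≋ τ₁′ → τ₂ ≋ τ₂′ → τ₂ ≈ₚ 0ₚ ⊎ ∃ (HasDeg τ₂) → SeqEq qs qs′ × u ≋ u′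
  euclid-deterministic (done _) (done _) τ₁≋τ₁′ _ _ = [] , τ₁≋τ₁′
  euclid-deterministic (done τ₂≈0) (step τ₂′≉0 _ _ _) _ τ₂≋τ₂′ _ =
    ⊥-elim (τ₂′≉0 (≋⇒≈ₚ (≋-trans (≋-sym τ₂≋τ₂′) (coeffwise {q = 0ₚ} τ₂≈0))))
  euclid-deterministic (step τ₂≉0 _ _ _) (done τ₂′≈0) _ τ₂≋τ₂′ _ =
    ⊥-elim (τ₂≉0 (≋⇒≈ₚ (≋-trans τ₂≋τ₂′ (coeffwise {q = 0ₚ} τ₂′≈0))))
  euclid-deterministic (step τ₂≉0 _ _ _) (step _ _ _ _) _ _ (inj₁ τ₂≈0) = ⊥-elim (τ₂≉0 τ₂≈0)
  euclid-deterministic {τ₁} {τ₂} {τ₁′ = τ₁′} {τ₂′}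
    (step {q = q} {t} {qs} {u} _ τ₁≈qτ₂+t t-rem rest) (step {q = q′} {t′} {qs′} {u′} _ τ₁′≈q′τ₂′+t′ t′-rem rest′)
    τ₁≋τ₁′ τ₂≋τ₂′ (inj₂ (e , τ₂-deg)) =
    (≋⇒≈ₚ (proj₁ division) ∷ proj₁ continue) , proj₂ continue
    where
    same-dividend : q *ₚ τ₂ +ₚ t ≋ q′ *ₚ τ₂ +ₚ t′
    same-dividend = ≋-trans (≋-sym (coeffwise {τ₁} τ₁≈qτ₂+t)) (≋-trans τ₁≋τ₁′ (≋-trans (coeffwise {τ₁′} τ₁′≈q′τ₂′+t′)
      (+ₚ-cong (*ₚ-cong (≋-refl {q′}) (≋-sym τ₂≋τ₂′)) (≋-refl {t′}))))
    division : q ≋ q′ × t ≋ t′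
    division = division-unique q q′ t t′ τ₂ τ₂-deg (remainder-DegBelow t τ₂ τ₂-deg t-rem)
      (remainder-DegBelow t′ τ₂′ (HasDeg-resp-≋ τ₂≋τ₂′ τ₂-deg) t′-rem) same-dividend
    continue : SeqEq qs qs′ × u ≋ u′
    continue = euclid-deterministic rest rest′ τ₂≋τ₂′ (proj₂ division) (remainder-zero-or-HasDeg t τ₂ t-rem)

  euclid-scale : ∀ {τ₁ τ₂ qs u} α β {α′ β′} → α * α′ ≈ 1# → β * β′ ≈ 1# → Euclid τ₁ τ₂ qs u →
    Euclid (α ·ₚ τ₁) (β ·ₚ τ₂) (scaleAlt (α * β′) (β * α′) qs) (altW α β (length qs) ·ₚ u)
  euclid-scale {τ₂ = τ₂} α β αα′≈1 ββ′≈1 (done τ₂≈0) =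
    done (≋⇒≈ₚ (·ₚ-cong {p = τ₂} {q = 0ₚ} refl (coeffwise τ₂≈0)))
  euclid-scale {τ₁} {τ₂} α β {α′} {β′} αα′≈1 ββ′≈1 (step {q = q} {t} τ₂≉0 τ₁≈qτ₂+t t-rem rest) =
    step βτ₂≉0 (≋⇒≈ₚ scaled-division) (scaled-remainder t-rem) (euclid-scale β α ββ′≈1 αα′≈1 rest)
    where
    open ≋-Reasoning
    open PolySolver using (solve; _:+_; _:*_; _:=_)
    βτ₂≉0 : ¬ (β ·ₚ τ₂ ≈ₚ 0ₚ)
    βτ₂≉0 βτ₂≈0 = τ₂≉0 λ i → x*y≈0⇒x≈0 (invertible⇒≉0 ββ′≈1)
      (trans (*-comm _ β) (trans (sym (coeff-·ₚ β τ₂ i)) (βτ₂≈0 i)))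
    scaled-division : α ·ₚ τ₁ ≋ ((α * β′) ·ₚ q) *ₚ (β ·ₚ τ₂) +ₚ α ·ₚ t
    scaled-division = begin
      α ·ₚ τ₁                                    ≈⟨ ≋-trans (·ₚ≋C*ₚ α τ₁) (*ₚ-cong (≋-refl {C α}) (coeffwise {τ₁} τ₁≈qτ₂+t)) ⟩
      C α *ₚ (q *ₚ τ₂ +ₚ t)                      ≈⟨ solve 4 (λ a q τ t → a :* (q :* τ :+ t) := a :* q :* τ :+ a :* t) ≋-refl (C α) q τ₂ t ⟩
      C α *ₚ q *ₚ τ₂ +ₚ C α *ₚ t                 ≈⟨ +ₚ-cong (*ₚ-cong (*ₚ-cong (≋-sym C-αβ′β) (≋-refl {q})) (≋-refl {τ₂})) (≋-refl {C α *ₚ t}) ⟩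
      C (α * β′) *ₚ C β *ₚ q *ₚ τ₂ +ₚ C α *ₚ t   ≈⟨ solve 5 (λ a b q τ x → a :* b :* q :* τ :+ x := (a :* q) :* (b :* τ) :+ x) ≋-refl (C (α * β′)) (C β) q τ₂ (C α *ₚ t) ⟩
      (C (α * β′) *ₚ q) *ₚ (C β *ₚ τ₂) +ₚ C α *ₚ t ≈⟨ +ₚ-cong (*ₚ-cong (·ₚ≋C*ₚ (α * β′) q) (·ₚ≋C*ₚ β τ₂)) (·ₚ≋C*ₚ α t) ⟨
      ((α * β′) ·ₚ q) *ₚ (β ·ₚ τ₂) +ₚ α ·ₚ t     ∎
      where
      C-αβ′β : C (α * β′) *ₚ C β ≋ C α
      C-αβ′β = ≋-trans (C-*ₚ-C (α * β′) β)
        (C-cong (trans (*-assoc α β′ β) (trans (*-congˡ (trans (*-comm β′ β) ββ′≈1)) (*-identityʳ α))))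
    scaled-remainder : t ≈ₚ 0ₚ ⊎ DegLt t τ₂ → α ·ₚ t ≈ₚ 0ₚ ⊎ DegLt (α ·ₚ t) (β ·ₚ τ₂)
    scaled-remainder (inj₁ t≈0) = inj₁ (≋⇒≈ₚ (·ₚ-cong {p = t} {q = 0ₚ} refl (coeffwise t≈0)))
    scaled-remainder (inj₂ (d , e , t-deg , τ₂-deg , d<e)) =
      inj₂ (d , e , HasDeg-·ₚ t (invertible⇒≉0 αα′≈1) t-deg , HasDeg-·ₚ τ₂ (invertible⇒≉0 ββ′≈1) τ₂-deg , d<e)

  -- Running the algorithm on (num, μ·den) = (num, prevNum) rescales the quotients alternately and,
  -- as num and prevNum of qs are num and den of reverse qs, also yields the reversed quotients.
  euclid-palindrome : ∀ {qs μ μ′} → All NonConstant qs → μ * μ′ ≈ 1# → μ ·ₚ den qs ≋ prevNum qs →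
    SeqEq (scaleAlt μ′ μ qs) (reverse qs) × altW 1# μ (length qs) ≈ 1#
  euclid-palindrome {qs} {μ} {μ′} qs-nc μμ′≈1 μden≋prevNum =
    SeqEq.trans (scaleAlt-cong (sym (*-identityˡ μ′)) (sym (*-identityʳ μ)) SeqEq.refl) (proj₁ same-run) ,
    trans (sym (*-identityʳ _)) (trans (sym (coeff-·ₚ _ 1ₚ 0)) (≋⇒≈ₚ (proj₂ same-run) 0))
    where
    reversed : convergents (reverse qs) ≋ₘ transpose (convergents qs)
    reversed = convergents-reverse qs
    scaled-run : Euclid (1# ·ₚ num qs) (μ ·ₚ den qs) (scaleAlt (1# * μ′) (μ * 1#) qs) (altW 1# μ (length qs) ·ₚ 1ₚ)
    scaled-run = euclid-scale 1# μ {1#} {μ′} (*-identityʳ 1#) μμ′≈1 (euclid-of-convergents qs-nc)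
    reversed-run : Euclid (num (reverse qs)) (den (reverse qs)) (reverse qs) 1ₚ
    reversed-run = euclid-of-convergents (All-reverse qs-nc)
    μden-zero-or-HasDeg : μ ·ₚ den qs ≈ₚ 0ₚ ⊎ ∃ (HasDeg (μ ·ₚ den qs))
    μden-zero-or-HasDeg with den-DegLt-num qs-nc
    ... | inj₁ den≈0 = inj₁ (≋⇒≈ₚ (·ₚ-cong {p = den qs} {q = 0ₚ} refl (coeffwise den≈0)))
    ... | inj₂ (d , _ , den-deg , _) = inj₂ (d , HasDeg-·ₚ (den qs) (invertible⇒≉0 μμ′≈1) den-deg)
    same-run : SeqEq (scaleAlt (1# * μ′) (μ * 1#) qs) (reverse qs) × altW 1# μ (length qs) ·ₚ 1ₚ ≋ 1ₚ
    same-run = euclid-deterministic scaled-run reversed-run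
      (≋-trans (·ₚ-identityˡ (num qs)) (≋-sym (≋₁₁ reversed)))
      (≋-trans μden≋prevNum (≋-sym (≋₂₁ reversed)))
      μden-zero-or-HasDeg

module SumOfTwoSquares {c ℓ : Level} (R : CommutativeRing c ℓ) (isField : IsField R) where
  open CommutativeRing R renaming (Carrier to F)
  open import Algebra.Properties.Ring ring using (-1*x≈-x; -‿involutive)
  open IsField isField
  open Poly R
  open PolynomialRing R
  open Degrees R
  open FieldDegrees R isField
  open Convergents R
  open AlternatingScaling R
  open EuclideanAlgorithm R isField

  signedSquare : F → ℕ → F
  signedSquare a n = a * a * altW 1# (- 1#) n

  altW-sign : ∀ n → (altW 1# 0# n + - 1# * altW 0# 1# n ≈ altW 1# (- 1#) n) ×
                    (altW 0# 1# n + - 1# * altW 1# 0# n ≈ altW (- 1#) 1# n)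
  altW-sign zero    = trans (+-congˡ (zeroʳ _)) (+-identityʳ 1#) , trans (+-identityˡ _) (*-identityʳ _)
  altW-sign (suc n) = swap (altW-sign n)

  altW-square : ∀ {x y} → x * x ≈ 1# → y * y ≈ 1# → ∀ n → altW x y n * altW x y n ≈ 1#
  altW-square x²≈1 y²≈1 zero    = x²≈1
  altW-square x²≈1 y²≈1 (suc n) = altW-square y²≈1 x²≈1 n

  [-1]²≈1 : - 1# * - 1# ≈ 1#
  [-1]²≈1 = trans (-1*x≈-x (- 1#)) (-‿involutive 1#)

  prevNum≋signed-den : ∀ qs γ k → All NonConstant qs → C γ *ₚ den qs *ₚ den qs +ₚ 1ₚ ≋ num qs *ₚ k →
                       prevNum qs ≋ (γ * altW 1# (- 1#) (length qs)) ·ₚ den qs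
  prevNum≋signed-den qs γ k qs-nc γden²+1≋numk = begin
    x′                                              ≈⟨ +ₚ-moveʳ {x′} {C γ *ₚ y *ₚ C e₀} remainders ⟩
    C γ *ₚ y *ₚ C e₁ +ₚ -ₚ (C γ *ₚ y *ₚ C e₀)       ≈⟨ solve 5 (λ g y a b n → g :* y :* a :+ n :* (g :* y :* b) := (g :* (a :+ n :* b)) :* y) ≋-refl (C γ) y (C e₁) (C e₀) (C (- 1#)) ⟩
    (C γ *ₚ (C e₁ +ₚ C (- 1#) *ₚ C e₀)) *ₚ y        ≈⟨ *ₚ-cong (*ₚ-cong (≋-refl {C γ}) (+ₚ-cong (≋-refl {C e₁}) (C-*ₚ-C (- 1#) e₀))) (≋-refl {y}) ⟩
    (C γ *ₚ C (e₁ + - 1# * e₀)) *ₚ y                ≈⟨ *ₚ-cong (≋-trans (C-*ₚ-C γ _) (C-cong (*-congˡ (proj₁ (altW-sign n))))) (≋-refl {y}) ⟩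
    C (γ * altW 1# (- 1#) n) *ₚ y                   ≈⟨ ·ₚ≋C*ₚ _ y ⟨
    (γ * altW 1# (- 1#) n) ·ₚ y                     ∎
    where
    open ≋-Reasoning
    open PolySolver using (solve; _:+_; _:*_; _:=_)
    n : ℕ
    n = length qs
    x′ y : Pol
    x′ = prevNum qs
    y = den qs
    e₀ e₁ : F
    e₀ = altW 0# 1# n
    e₁ = altW 1# 0# n
    degrees : ∃ λ S → HasDeg (num qs) S × DegBelow y S
    degrees = convergents-degree qs-nc
    S : ℕ
    S = proj₁ degrees
    num-deg : HasDeg (num qs) S
    num-deg = proj₁ (proj₂ degrees)
    γy-multiple : ∀ e → DegBelow (C γ *ₚ y *ₚ C e) S
    γy-multiple e = DegBelow-resp-≋ (≋-sym (begin
      C γ *ₚ y *ₚ C e       ≈⟨ solve 3 (λ g y e → g :* y :* e := (g :* e) :* y) ≋-refl (C γ) y (C e) ⟩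
      (C γ *ₚ C e) *ₚ y     ≈⟨ *ₚ-cong (C-*ₚ-C γ e) (≋-refl {y}) ⟩
      C (γ * e) *ₚ y        ≈⟨ ·ₚ≋C*ₚ (γ * e) y ⟨
      (γ * e) ·ₚ y          ∎)) (DegBelow-·ₚ (γ * e) y (proj₂ (proj₂ degrees)))
    remainders : x′ +ₚ C γ *ₚ y *ₚ C e₀ ≋ C γ *ₚ y *ₚ C e₁
    remainders = proj₂ (division-unique (C γ *ₚ y *ₚ prevDen qs) (k *ₚ x′) (x′ +ₚ C γ *ₚ y *ₚ C e₀) (C γ *ₚ y *ₚ C e₁)
      (num qs) num-deg (DegBelow-+ₚ x′ _ (prevNum-DegBelow qs-nc num-deg) (γy-multiple e₀)) (γy-multiple e₁)
      (prevNum-congruence qs (C γ) k γden²+1≋numk))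

  euclid-nonempty : ∀ {τ₁ τ₂ qs u} → ¬ (τ₂ ≈ₚ 0ₚ) → Euclid τ₁ τ₂ qs u → 0 < length qs
  euclid-nonempty τ₂≉0 (done τ₂≈0)  = ⊥-elim (τ₂≉0 τ₂≈0)
  euclid-nonempty τ₂≉0 (step _ _ _ _) = s≤s z≤n

  euclid-square-congruence : ∀ {m z qs u k} → Euclid m z qs u → z *ₚ z +ₚ 1ₚ ≋ m *ₚ k →
                             (u *ₚ den qs) *ₚ (u *ₚ den qs) +ₚ 1ₚ ≋ (u *ₚ num qs) *ₚ k
  euclid-square-congruence {k = k} euclid z²+1≋mk =
    let m≋ , z≋ = euclid-convergents euclid
    in ≋-trans (+ₚ-cong (*ₚ-cong (≋-sym z≋) (≋-sym z≋)) (≋-refl {1ₚ})) (≋-trans z²+1≋mk (*ₚ-cong m≋ (≋-refl {k})))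

  last-remainder-constant : ∀ {m z qs u k d} → Euclid m z qs u → HasDeg u d → z *ₚ z +ₚ 1ₚ ≋ m *ₚ k →
                            u ≋ C (coeff u 0) × ¬ (coeff u 0 ≈ 0#)
  last-remainder-constant {qs = qs} {u} {k} euclid u-deg z²+1≋mk =
    HasDeg-0⇒≋C u u-deg₀ , proj₁ u-deg₀
    where
    open ≋-Reasoning
    open PolySolver using (solve; _:+_; _:*_; _:=_; con)
    u∣1 : u *ₚ (u *ₚ den qs *ₚ den qs) +ₚ 1ₚ ≋ u *ₚ (num qs *ₚ k)
    u∣1 = begin
      u *ₚ (u *ₚ den qs *ₚ den qs) +ₚ 1ₚ       ≈⟨ solve 2 (λ u y → u :* (u :* y :* y) :+ con 1 := (u :* y) :* (u :* y) :+ con 1) ≋-refl u (den qs) ⟩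
      (u *ₚ den qs) *ₚ (u *ₚ den qs) +ₚ 1ₚ     ≈⟨ euclid-square-congruence euclid z²+1≋mk ⟩
      (u *ₚ num qs) *ₚ k                       ≈⟨ *ₚ-assoc u (num qs) k ⟩
      u *ₚ (num qs *ₚ k)                       ∎
    u-deg₀ : HasDeg u 0
    u-deg₀ = ≡.subst (HasDeg u) (unit⇒HasDeg-0 u _ (u*x+1≋u*y⇒u*[y-x]≋1 u _ _ u∣1) u-deg) u-deg

  euclid-prevNum : ∀ {m z qs u k a} → Euclid m z qs u → All NonConstant qs → u ≋ C a → z *ₚ z +ₚ 1ₚ ≋ m *ₚ k →
                   prevNum qs ≋ signedSquare a (length qs) ·ₚ den qs
  euclid-prevNum {qs = qs} {u} {k} {a} euclid qs-nc u≋Ca z²+1≋mk = prevNum≋signed-den qs (a * a) (C a *ₚ k) qs-nc (begin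
    C (a * a) *ₚ den qs *ₚ den qs +ₚ 1ₚ        ≈⟨ +ₚ-cong (*ₚ-cong (*ₚ-cong (≋-sym (C-*ₚ-C a a)) (≋-refl {den qs})) (≋-refl {den qs})) (≋-refl {1ₚ}) ⟩
    C a *ₚ C a *ₚ den qs *ₚ den qs +ₚ 1ₚ       ≈⟨ solve 2 (λ a y → a :* a :* y :* y :+ con 1 := (a :* y) :* (a :* y) :+ con 1) ≋-refl (C a) (den qs) ⟩
    (C a *ₚ den qs) *ₚ (C a *ₚ den qs) +ₚ 1ₚ   ≈⟨ +ₚ-cong (*ₚ-cong (*ₚ-cong (≋-sym u≋Ca) (≋-refl {den qs})) (*ₚ-cong (≋-sym u≋Ca) (≋-refl {den qs}))) (≋-refl {1ₚ}) ⟩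
    (u *ₚ den qs) *ₚ (u *ₚ den qs) +ₚ 1ₚ       ≈⟨ euclid-square-congruence euclid z²+1≋mk ⟩
    (u *ₚ num qs) *ₚ k                         ≈⟨ *ₚ-cong (*ₚ-cong u≋Ca (≋-refl {num qs})) (≋-refl {k}) ⟩
    (C a *ₚ num qs) *ₚ k                       ≈⟨ solve 3 (λ a x k → (a :* x) :* k := x :* (a :* k)) ≋-refl (C a) (num qs) k ⟩
    num qs *ₚ (C a *ₚ k)                       ∎)
    where
    open ≋-Reasoning
    open PolySolver using (solve; _:+_; _:*_; _:=_; con)

  num²+den²≋cont²+cont′² : ∀ ps → 0 < length ps →
    num ps *ₚ num ps +ₚ den ps *ₚ den ps ≋ cont ps *ₚ cont ps +ₚ cont (drop 1 ps) *ₚ cont (drop 1 ps)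
  num²+den²≋cont²+cont′² (p ∷ ps) _ =
    +ₚ-cong (*ₚ-cong (≋-sym (cont≋num (p ∷ ps))) (≋-sym (cont≋num (p ∷ ps))))
            (*ₚ-cong (≋-sym (cont≋num ps)) (≋-sym (cont≋num ps)))

  signedSquare-inverse : ∀ {a b} n → a * b ≈ 1# → signedSquare a n * signedSquare b n ≈ 1#
  signedSquare-inverse {a} {b} n ab≈1 = begin
    (a * a * σ) * (b * b * σ)    ≈⟨ Scalar.solve 3 (λ a b σ → (a :* a :* σ) :* (b :* b :* σ) := (a :* b) :* (a :* b) :* (σ :* σ)) refl a b σ ⟩
    (a * b) * (a * b) * (σ * σ)  ≈⟨ *-cong (*-cong ab≈1 ab≈1) (altW-square (*-identityˡ 1#) [-1]²≈1 n) ⟩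
    1# * 1# * 1#                 ≈⟨ trans (*-identityʳ _) (*-identityˡ 1#) ⟩
    1#                           ∎
    where
    open SetoidReasoning setoid
    open Scalar using (_:*_; _:=_)
    σ : F
    σ = altW 1# (- 1#) n

  odd-length⇒a²≈-1 : ∀ {a} n s → n ≡ suc (s ℕ.+ s) → altW 1# (signedSquare a n) n ≈ 1# → a * a ≈ - 1#
  odd-length⇒a²≈-1 {a} _ s ≡.refl μ≈1 = begin
    a * a                    ≈⟨ *-identityʳ _ ⟨
    a * a * 1#               ≈⟨ *-congˡ [-1]²≈1 ⟨
    a * a * (- 1# * - 1#)    ≈⟨ *-assoc _ _ _ ⟨
    a * a * - 1# * - 1#      ≈⟨ *-congʳ a²·[-1]≈1 ⟩
    1# * - 1#                ≈⟨ *-identityˡ _ ⟩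
    - 1#                     ∎
    where
    open SetoidReasoning setoid
    a²·[-1]≈1 : a * a * - 1# ≈ 1#
    a²·[-1]≈1 = ≡.subst (_≈ 1#) (≡.trans (altW-double s _ 1#) (≡.cong (a * a *_) (altW-double s (- 1#) 1#))) μ≈1

  even-length-representation : ∀ {m z qs u a b} s → Euclid m z qs u → ¬ (z ≈ₚ 0ₚ) → a * b ≈ 1# → u ≋ C a →
    length qs ≡ s ℕ.+ s →
    SeqEq (scaleAlt (signedSquare b (length qs)) (signedSquare a (length qs)) qs) (reverse qs) →
    ∃ λ ps → length ps ≡ s × SeqEq qs (palSeq a b s ps) ×
             m ≈ₚ C a *ₚ (cont ps *ₚ cont ps +ₚ cont (drop 1 ps) *ₚ cont (drop 1 ps))
  even-length-representation {m} {z} {qs} {u} {a} {b} s euclid z≉0 ab≈1 u≋Ca |qs|≡s+s scaled-palindrome =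
    ps , |ps|≡s , qs≈palSeq , ≋⇒≈ₚ m≋sum-of-squares
    where
    open ≋-Reasoning
    x*σ≈x : ∀ x → x * altW 1# (- 1#) (length qs) ≈ x
    x*σ≈x x = trans (*-congˡ (reflexive (≡.trans (≡.cong (altW 1# (- 1#)) |qs|≡s+s) (altW-double s 1# (- 1#)))))
                    (*-identityʳ x)
    palindrome : ∃ λ ps → length ps ≡ s × SeqEq qs (palSeq a b s ps)
    palindrome = palSeq-of-scaled-palindrome ab≈1 s qs |qs|≡s+s
      (SeqEq.trans (scaleAlt-cong (sym (x*σ≈x (b * b))) (sym (x*σ≈x (a * a))) SeqEq.refl) scaled-palindrome)
    ps : List Pol
    ps = proj₁ palindrome
    |ps|≡s : length ps ≡ s
    |ps|≡s = proj₁ (proj₂ palindrome)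
    qs≈palSeq : SeqEq qs (palSeq a b s ps)
    qs≈palSeq = proj₂ (proj₂ palindrome)
    ps-nonempty : 0 < length ps
    ps-nonempty = ≡.subst (0 <_) (≡.sym |ps|≡s) (0<n+n⇒0<n s (≡.subst (0 <_) |qs|≡s+s (euclid-nonempty z≉0 euclid)))
    m≋sum-of-squares : m ≋ C a *ₚ (cont ps *ₚ cont ps +ₚ cont (drop 1 ps) *ₚ cont (drop 1 ps))
    m≋sum-of-squares = begin
      m                                                ≈⟨ proj₁ (euclid-convergents euclid) ⟩
      u *ₚ num qs                                      ≈⟨ *ₚ-cong u≋Ca (≋₁₁ (convergents-cong qs≈palSeq)) ⟩
      C a *ₚ num (palSeq a b s ps)                     ≈⟨ *ₚ-cong (≋-refl {C a}) (num-palSeq ab≈1 s ps |ps|≡s) ⟩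
      C a *ₚ (num ps *ₚ num ps +ₚ den ps *ₚ den ps)    ≈⟨ *ₚ-cong (≋-refl {C a}) (num²+den²≋cont²+cont′² ps ps-nonempty) ⟩
      C a *ₚ (cont ps *ₚ cont ps +ₚ cont (drop 1 ps) *ₚ cont (drop 1 ps)) ∎

proposition3 : ∀ {c ℓ : Level} (R : CommutativeRing c ℓ) → IsField R →
  let open CommutativeRing R
      open Poly R
  in ¬ (1# + 1# ≈ 0#) →
     (∀ a → ¬ (a * a ≈ - 1#)) →
     ∀ (m z : Pol) →
     ¬ IsUnitₚ m →
     m ∣ₚ (z *ₚ z +ₚ 1ₚ) →
     (z ≈ₚ 0ₚ ⊎ DegLt z m) →
     ∀ (qs : List Pol) (u : Pol) → Euclid m z qs u →
     ∃₂ λ (a b : Carrier) →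
       ¬ (a ≈ 0#) × a * b ≈ 1# × u ≈ₚ C a ×
       ∃₂ λ (s : ℕ) (ps : List Pol) →
         length ps ≡ s ×
         SeqEq qs (palSeq a b s ps) ×
         m ≈ₚ C a *ₚ (cont ps *ₚ cont ps +ₚ cont (drop 1 ps) *ₚ cont (drop 1 ps))
proposition3 R isField _ _ m z m-nonunit (k , z²+1≈mk) (inj₁ z≈0) qs u euclid =
  ⊥-elim (m-nonunit (k , ≋⇒≈ₚ (≋-trans (≋-sym (coeffwise {z *ₚ z +ₚ 1ₚ} {m *ₚ k} z²+1≈mk)) (+ₚ-cong (*ₚ-cong z≋0 z≋0) (≋-refl {1ₚ})))))
  where
  open Poly R
  open PolynomialRing R
  z≋0 : z ≋ 0ₚ
  z≋0 = coeffwise z≈0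
proposition3 R isField _ ¬a²≈-1 m z _ (k , z²+1≈mk) z<m@(inj₂ (_ , _ , z-deg , m-deg , _)) qs u euclid =
  a , b , a≉0 , ab≈1 , ≋⇒≈ₚ u≋Ca , result
  where
  open CommutativeRing R renaming (Carrier to F)
  open IsField isField
  open Poly R
  open PolynomialRing R
  open Degrees R
  open AlternatingScaling R
  open EuclideanAlgorithm R isField
  open SumOfTwoSquares R isField
  z²+1≋mk : z *ₚ z +ₚ 1ₚ ≋ m *ₚ k
  z²+1≋mk = coeffwise {z *ₚ z +ₚ 1ₚ} {m *ₚ k} z²+1≈mk
  degrees : All NonConstant qs × ∃ (HasDeg u)
  degrees = euclid-degrees euclid m-deg z<m
  a : F
  a = coeff u 0
  u-constant : u ≋ C a × ¬ (a ≈ 0#)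
  u-constant = last-remainder-constant euclid (proj₂ (proj₂ degrees)) z²+1≋mk
  u≋Ca : u ≋ C a
  u≋Ca = proj₁ u-constant
  a≉0 : ¬ (a ≈ 0#)
  a≉0 = proj₂ u-constant
  b : F
  b = proj₁ (inverse a a≉0)
  ab≈1 : a * b ≈ 1#
  ab≈1 = proj₂ (inverse a a≉0)
  palindrome : SeqEq (scaleAlt (signedSquare b (length qs)) (signedSquare a (length qs)) qs) (reverse qs) ×
               altW 1# (signedSquare a (length qs)) (length qs) ≈ 1#
  palindrome = euclid-palindrome (proj₁ degrees) (signedSquare-inverse (length qs) ab≈1)
                 (≋-sym (euclid-prevNum euclid (proj₁ degrees) u≋Ca z²+1≋mk))
  result : ∃₂ λ s ps → length ps ≡ s × SeqEq qs (palSeq a b s ps) ×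
                       m ≈ₚ C a *ₚ (cont ps *ₚ cont ps +ₚ cont (drop 1 ps) *ₚ cont (drop 1 ps))
  result = [ (λ (s , |qs|≡s+s) → s , even-length-representation s euclid (HasDeg-≉0ₚ z z-deg) ab≈1 u≋Ca |qs|≡s+s (proj₁ palindrome))
           , (λ (s , |qs|≡1+s+s) → ⊥-elim (¬a²≈-1 a (odd-length⇒a²≈-1 (length qs) s |qs|≡1+s+s (proj₂ palindrome))))
           ]′ (even⊎odd (length qs))
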